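{- Let $f=(A,B,C)$ be a partially reduced imaginary or unusual binary quadratic form over $\mathbb{F}_q[t]$, and suppose $f=f\circ M$ for some $M\in GL_2(\mathbb{F}_q[t])$. Let $J=\begin{pmatrix}1&0\\0&-1\end{pmatrix}$. If $|A|<|C|$, then $M=\pm I$, or $M=\pm J$ if $B=0$. If $|A|=|C|$, then $M=\begin{pmatrix}\alpha&\beta\\ -u\lambda\beta & u\alpha\end{pmatrix}$ where $\alpha,\beta\in\mathbb{F}_q$, $\lambda=-4/h$ and $u:=\det(M)=\pm1$. If moreover $\beta\neq0$, then $B\neq0$ and $\alpha=u\beta(C\lambda-A)/B\in\mathbb{F}_q$. Hence such non-trivial automorphisms (with $\beta\ne 0$) exist if and only if $((C\lambda-A)/B)^2+\lambda$ is a square in $\mathbb{F}_q^*$, in which case there are two such non-trivial automorphisms.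
   Context: Let $q$ be a power of a prime $p\ge 5$. For nonzero $H\in\mathbb{F}_q[t]$ put $|H|=q^{\deg H}$, and let $\mathrm{sgn}(H)$ be the leading coefficient. Fix a primitive root $h$ of $\mathbb{F}_q^*$ and set $S=\{h^i:0\le i\le (q-3)/2\}$. A binary quadratic form $(A,B,C)$ is $Ax^2+Bxy+Cy^2$ with coefficients in $\mathbb{F}_q[t]$ and discriminant $D=B^2-4AC$; forms are assumed primitive, irreducible over $\mathbb{F}_q[t]$, with nonzero discriminant $D\notin\mathbb{F}_q$. $D$ is imaginary if $\deg D$ is odd, unusual if $\deg D$ is even and $\mathrm{sgn}(D)$ is a non-square in $\mathbb{F}_q^*$; discriminants are normalized so that $\mathrm{sgn}(D)\in\{1,h\}$. For $M=\begin{pmatrix}\alpha&\beta\\ \gamma&\delta\end{pmatrix}$, $(f\circ M)(x,y)=f(\alpha x+\beta y,\gamma x+\delta y)$; $GL_2(\mathbb{F}_q[t])$ is the group of $2\times2$ matrices over $\mathbb{F}_q[t]$ with determinant in $\mathbb{F}_q^*$. An imaginary or unusual form $(A,B,C)$ is partially reduced if: (1) $|B|<|A|\le|C|$; (2) if $|A|<|C|$ then $\mathrm{sgn}(A)\in\{1,h\}$, and if $|A|=|C|$ then $\mathrm{sgn}(A)=1$; (3) $B\neq0$ implies $\mathrm{sgn}(B)\in S$. -}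

module Defs where

open import Data.Nat as ℕ using (ℕ; zero; suc; _≤_; _<_; _∸_)
open import Data.Nat.DivMod using (_/_; _%_)
open import Data.List using (List; []; _∷_; length; map)
open import Data.List.Membership.Propositional using (_∈_)
open import Data.List.Relation.Unary.Unique.Propositional using (Unique)
open import Data.Product using (Σ; ∃; _×_; _,_)
open import Data.Sum using (_⊎_)
open import Relation.Nullary using (¬_; yes; no)
open import Relation.Binary.Definitions using (DecidableEquality)
open import Relation.Binary.PropositionalEquality using (_≡_)
open import Algebra.Structures using (IsCommutativeRing)

record FiniteField : Set₁ where
  infixl 6 _+_
  infixl 7 _*_
  field
    Carrier           : Set
    _+_ _*_           : Carrier → Carrier → Carrier
    -_                : Carrier → Carrier
    0# 1#             : Carrier
    isCommutativeRing : IsCommutativeRing _≡_ _+_ _*_ -_ 0# 1#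
    _⁻¹               : Carrier → Carrier
    ⁻¹-inverse        : ∀ x → ¬ x ≡ 0# → x * (x ⁻¹) ≡ 1#
    0≢1               : ¬ 0# ≡ 1#
    _≟_               : DecidableEquality Carrier
    elements          : List Carrier
    complete          : ∀ x → x ∈ elements
    unique            : Unique elements

  q : ℕ
  q = length elements

module Over (𝔽 : FiniteField) where
  open FiniteField 𝔽

  natToF : ℕ → Carrier
  natToF zero    = 0#
  natToF (suc n) = 1# + natToF n

  4# : Carrier
  4# = natToF 4

  pow : Carrier → ℕ → Carrier
  pow x zero    = 1#
  pow x (suc n) = x * pow x n

  IsPrimitiveRoot : Carrier → Set
  IsPrimitiveRoot h = ∀ x → ¬ x ≡ 0# → ∃ λ i → pow h i ≡ x

  IsSquare : Carrier → Set
  IsSquare x = ∃ λ y → y * y ≡ x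

  InS : Carrier → Carrier → Set
  InS h x = ∃ λ i → i ≤ (q ∸ 3) / 2 × pow h i ≡ x

  -- Polynomials in F_q[t]: coefficient lists, lowest degree first.
  -- Two lists represent the same polynomial iff their normal forms
  -- (trailing zeros removed) coincide.

  Poly : Set
  Poly = List Carrier

  norm : Poly → Poly
  norm []       = []
  norm (a ∷ as) with norm as
  ... | b ∷ bs = a ∷ b ∷ bs
  ... | []     with a ≟ 0#
  ...   | yes _ = []
  ...   | no  _ = a ∷ []

  infix 4 _≈ₚ_
  _≈ₚ_ : Poly → Poly → Set
  p ≈ₚ r = norm p ≡ norm r

  0ₚ : Poly
  0ₚ = []

  const : Carrier → Poly
  const a = a ∷ []

  -- size p = deg p + 1 for p ≠ 0, and size 0 = 0.  Hence
  -- |P| < |Q|  iff  size P < size Q, and |P| = |Q| iff size P ≡ size Q.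
  size : Poly → ℕ
  size p = length (norm p)

  deg : Poly → ℕ
  deg p = size p ∸ 1

  private
    lastOr0 : List Carrier → Carrier
    lastOr0 []           = 0#
    lastOr0 (a ∷ [])     = a
    lastOr0 (_ ∷ b ∷ bs) = lastOr0 (b ∷ bs)

  sgn : Poly → Carrier
  sgn p = lastOr0 (norm p)

  infixl 6 _+ₚ_ _-ₚ_
  infixl 7 _*ₚ_

  _+ₚ_ : Poly → Poly → Poly
  []       +ₚ r        = r
  (a ∷ p)  +ₚ []       = a ∷ p
  (a ∷ p)  +ₚ (b ∷ r)  = (a + b) ∷ (p +ₚ r)

  negₚ : Poly → Poly
  negₚ = map -_

  _-ₚ_ : Poly → Poly → Poly
  p -ₚ r = p +ₚ negₚ r

  scale : Carrier → Poly → Poly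
  scale c = map (c *_)

  _*ₚ_ : Poly → Poly → Poly
  []      *ₚ r = []
  (a ∷ p) *ₚ r = scale a r +ₚ (0# ∷ (p *ₚ r))

  _∣ₚ_ : Poly → Poly → Set
  g ∣ₚ a = ∃ λ k → a ≈ₚ g *ₚ k

  IsUnit : Poly → Set
  IsUnit g = ∃ λ k → g *ₚ k ≈ₚ const 1#

  -- Binary quadratic forms (A,B,C) = A x² + B x y + C y²

  record Form : Set where
    constructor form
    field
      A B C : Poly

  disc : Form → Poly
  disc (form A B C) = B *ₚ B -ₚ const 4# *ₚ (A *ₚ C)

  Primitive : Form → Set
  Primitive (form A B C) = ∀ g → g ∣ₚ A → g ∣ₚ B → g ∣ₚ C → IsUnit g

  Irreducible : Form → Set
  Irreducible (form A B C) =
    ¬ (Σ Poly λ a → Σ Poly λ b → Σ Poly λ c → Σ Poly λ d →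
         (A ≈ₚ a *ₚ c) × (B ≈ₚ a *ₚ d +ₚ b *ₚ c) × (C ≈ₚ b *ₚ d))

  NonConstant : Poly → Set
  NonConstant D = 2 ≤ size D

  Imaginary : Poly → Set
  Imaginary D = deg D % 2 ≡ 1

  Unusual : Poly → Set
  Unusual D = deg D % 2 ≡ 0 × ¬ IsSquare (sgn D)

  Normalized : Carrier → Poly → Set
  Normalized h D = sgn D ≡ 1# ⊎ sgn D ≡ h

  PartiallyReduced : Carrier → Form → Set
  PartiallyReduced h (form A B C) =
      (size B < size A × size A ≤ size C)
    × (size A < size C → sgn A ≡ 1# ⊎ sgn A ≡ h)
    × (size A ≡ size C → sgn A ≡ 1#)
    × (¬ B ≈ₚ 0ₚ → InS h (sgn B))

  record Mat : Set where
    constructor mat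
    field
      α β γ δ : Poly

  det : Mat → Poly
  det (mat α β γ δ) = α *ₚ δ -ₚ β *ₚ γ

  InGL2 : Mat → Set
  InGL2 M = ∃ λ u → ¬ u ≡ 0# × det M ≈ₚ const u

  infix 4 _≈M_
  _≈M_ : Mat → Mat → Set
  mat α β γ δ ≈M mat α' β' γ' δ' =
    (α ≈ₚ α') × (β ≈ₚ β') × (γ ≈ₚ γ') × (δ ≈ₚ δ')

  negM : Mat → Mat
  negM (mat α β γ δ) = mat (negₚ α) (negₚ β) (negₚ γ) (negₚ δ)

  I J : Mat
  I = mat (const 1#) 0ₚ 0ₚ (const 1#)
  J = mat (const 1#) 0ₚ 0ₚ (const (- 1#))

  -- (f ∘ M)(x,y) = f(αx+βy, γx+δy), written out coefficientwise
  _∘F_ : Form → Mat → Form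
  form A B C ∘F mat α β γ δ =
    form (A *ₚ α *ₚ α +ₚ B *ₚ α *ₚ γ +ₚ C *ₚ γ *ₚ γ)
         (const (1# + 1#) *ₚ A *ₚ α *ₚ β +ₚ B *ₚ (α *ₚ δ +ₚ β *ₚ γ)
           +ₚ const (1# + 1#) *ₚ C *ₚ γ *ₚ δ)
         (A *ₚ β *ₚ β +ₚ B *ₚ β *ₚ δ +ₚ C *ₚ δ *ₚ δ)

  infix 4 _≈F_
  _≈F_ : Form → Form → Set
  form A B C ≈F form A' B' C' = (A ≈ₚ A') × (B ≈ₚ B') × (C ≈ₚ C')

  IsAut : Form → Mat → Set
  IsAut f M = InGL2 M × (f ≈F f ∘F M)

  lam : Carrier → Carrier
  lam h = - (4# * (h ⁻¹))

{-# OPTIONS --safe #-}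
-- Let a = deg A ≤ c = deg C, so deg B < a.  Because the discriminant is imaginary or
-- unusual, the leading terms of A x² and C y² never cancel, hence
-- deg f(x, y) = max (a + 2 deg x, c + 2 deg y).  Comparing degrees in A = f(α, γ) and
-- C = f(β, δ) forces γ = 0 when a < c, and constant entries when a = c.
--
-- For a < c, the determinant and the leading coefficients of A and C give
-- M = diag(±1, ±1), and unequal signs force B = -B = 0.  For a = c, sgn A = 1 and
-- sgn C = 1/λ, so the leading coefficients say that M is an isometry of x² + y²/λ
-- over F_q; this gives u² = 1, δ = uα, γ = -uλβ and α² + λβ² = 1.  Comparing all
-- coefficients of A and B then yields αB = uβ(λC - A) and (1 + u)B = 0, so u = -1
-- when β ≠ 0 (then B ≠ 0, as B = 0 would make C divide A, B and C).  Conversely, if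
-- λC - A = kB and y² = k² + λ, the matrices (-βk β ; λβ βk) with β = ±1/y are
-- automorphisms, and every automorphism with β ≠ 0 is one of them.
module Submission where

open import Defs
open import Data.Nat as ℕ using (ℕ; zero; suc; z≤n; s≤s; _≤_; _<_; _^_)
import Data.Nat.Properties as ℕ
open import Data.Nat.DivMod using (_%_; _/_; m≡m%n+[m/n]*n; m%n<n; [m+kn]%n≡m%n; m*n%n≡0)
open import Data.Nat.Tactic.RingSolver using (solve-∀)
open import Data.Nat.Divisibility using (divides)
open import Data.Nat.Primality using (Prime; prime⇒irreducible)
open import Data.Integer as ℤ using (ℤ; -[1+_]; _⊖_)
import Data.Integer.Properties as ℤ
open import Data.Sign as Sign using (Sign)
open import Data.List using ([]; _∷_; length)
open import Data.Maybe using (Maybe; just; nothing)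
open import Data.Product using (Σ; ∃; ∃-syntax; _×_; _,_; proj₁; proj₂)
open import Data.Sum using (_⊎_; inj₁; inj₂; [_,_]′)
open import Data.Empty using (⊥-elim)
open import Relation.Nullary using (¬_; yes; no)
open import Relation.Binary.Definitions using (tri<; tri≈; tri>)
open import Relation.Binary.PropositionalEquality
  using (_≡_; _≢_; refl; sym; trans; cong; cong₂; subst; subst₂; module ≡-Reasoning)
open import Algebra.Bundles using (CommutativeRing; RawRing)
open import Algebra.Structures using (IsCommutativeRing)
import Algebra.Solver.Ring
import Algebra.Solver.Ring.AlmostCommutativeRing as ACR

-- The reflective solver of the standard library keeps its coefficients in the ring
-- itself, which does not normalise over an abstract field; hence integer coefficients.
module IntegerCoefficientSolver
  {a} {A : Set a} {plus times : A → A → A} {negate : A → A} {nought unit : A}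
  (isCommutativeRing : IsCommutativeRing _≡_ plus times negate nought unit) where

  private
    R : CommutativeRing a a
    R = record { isCommutativeRing = isCommutativeRing }
    open CommutativeRing R
      using (_+_; _*_; -_; 0#; 1#; +-identityˡ; +-identityʳ; +-assoc; +-comm; -‿inverseʳ;
             *-identityˡ; *-identityʳ; zeroʳ; semiring; ring)
    open import Algebra.Properties.Semiring.Mult semiring using (×-homo-+; ×1-homo-*) renaming (_×_ to _·_)
    open import Algebra.Properties.Ring ring using (-1*x≈-x; -‿involutive; -0#≈0#; -‿+-comm)
    open import Algebra.Properties.CommutativeSemigroup
      (CommutativeRing.*-commutativeSemigroup R) using (interchange)
    open ≡-Reasoning

    signed : Sign → A
    signed Sign.+ = 1#
    signed Sign.- = - 1#

    signed-* : ∀ s t → signed (s Sign.* t) ≡ signed s * signed t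
    signed-* Sign.+ t      = sym (*-identityˡ _)
    signed-* Sign.- Sign.+ = sym (*-identityʳ _)
    signed-* Sign.- Sign.- = begin
      1#            ≡⟨ -‿involutive 1# ⟨
      - - 1#        ≡⟨ -1*x≈-x (- 1#) ⟨
      - 1# * - 1#   ∎

    -- n · 1# with the shape 1# + (1# + …) and no trailing 0#, so that the solver's
    -- constant con (ℤ.+ 2) is literally 1# + 1#.
    natural : ℕ → A
    natural zero          = 0#
    natural (suc zero)    = 1#
    natural (suc (suc n)) = 1# + natural (suc n)

    natural≡·1# : ∀ n → natural n ≡ n · 1#
    natural≡·1# zero          = refl
    natural≡·1# (suc zero)    = sym (+-identityʳ 1#)
    natural≡·1# (suc (suc n)) = cong (1# +_) (natural≡·1# (suc n))

    ⟦_⟧ : ℤ → A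
    ⟦ ℤ.+ n ⟧    = natural n
    ⟦ -[1+ n ] ⟧ = - natural (suc n)

    ⟦-⟧ : ∀ n → ⟦ -[1+ n ] ⟧ ≡ - (suc n · 1#)
    ⟦-⟧ n = cong -_ (natural≡·1# (suc n))

    ⟦_⟧ˢ : ℤ → A
    ⟦ i ⟧ˢ = signed (ℤ.sign i) * (ℤ.∣ i ∣ · 1#)

    ⟦⟧≡⟦⟧ˢ : ∀ i → ⟦ i ⟧ ≡ ⟦ i ⟧ˢ
    ⟦⟧≡⟦⟧ˢ (ℤ.+ n)    = trans (natural≡·1# n) (sym (*-identityˡ _))
    ⟦⟧≡⟦⟧ˢ -[1+ n ]   = trans (⟦-⟧ n) (sym (-1*x≈-x _))

    ◃-homo : ∀ s n → ⟦ s ℤ.◃ n ⟧ˢ ≡ signed s * (n · 1#)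
    ◃-homo s      zero    = trans (zeroʳ _) (sym (zeroʳ _))
    ◃-homo Sign.+ (suc n) = refl
    ◃-homo Sign.- (suc n) = refl

    *-homo : ∀ i j → ⟦ i ℤ.* j ⟧ ≡ ⟦ i ⟧ * ⟦ j ⟧
    *-homo i j = begin
      ⟦ i ℤ.* j ⟧
        ≡⟨ ⟦⟧≡⟦⟧ˢ (i ℤ.* j) ⟩
      ⟦ i ℤ.* j ⟧ˢ
        ≡⟨ ◃-homo (ℤ.sign i Sign.* ℤ.sign j) (ℤ.∣ i ∣ ℕ.* ℤ.∣ j ∣) ⟩
      signed (ℤ.sign i Sign.* ℤ.sign j) * ((ℤ.∣ i ∣ ℕ.* ℤ.∣ j ∣) · 1#)
        ≡⟨ cong₂ _*_ (signed-* (ℤ.sign i) (ℤ.sign j)) (×1-homo-* ℤ.∣ i ∣ ℤ.∣ j ∣) ⟩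
      (signed (ℤ.sign i) * signed (ℤ.sign j)) * ((ℤ.∣ i ∣ · 1#) * (ℤ.∣ j ∣ · 1#))
        ≡⟨ interchange _ _ _ _ ⟩
      ⟦ i ⟧ˢ * ⟦ j ⟧ˢ
        ≡⟨ cong₂ _*_ (⟦⟧≡⟦⟧ˢ i) (⟦⟧≡⟦⟧ˢ j) ⟨
      ⟦ i ⟧ * ⟦ j ⟧ ∎

    ⊖-homo : ∀ m n → ⟦ m ⊖ n ⟧ ≡ m · 1# + - (n · 1#)
    ⊖-homo m zero = begin
      ⟦ m ⊖ 0 ⟧          ≡⟨ cong ⟦_⟧ (ℤ.⊖-≥ {m} z≤n) ⟩
      ⟦ ℤ.+ m ⟧          ≡⟨ natural≡·1# m ⟩
      m · 1#             ≡⟨ +-identityʳ _ ⟨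
      m · 1# + 0#        ≡⟨ cong ((m · 1#) +_) -0#≈0# ⟨
      m · 1# + - 0#      ∎
    ⊖-homo zero (suc n) = begin
      ⟦ 0 ⊖ suc n ⟧          ≡⟨ cong ⟦_⟧ (ℤ.⊖-< {0} {suc n} (s≤s z≤n)) ⟩
      ⟦ -[1+ n ] ⟧           ≡⟨ ⟦-⟧ n ⟩
      - (suc n · 1#)         ≡⟨ +-identityˡ _ ⟨
      0# + - (suc n · 1#)    ∎
    ⊖-homo (suc m) (suc n) = begin
      ⟦ suc m ⊖ suc n ⟧                      ≡⟨ cong ⟦_⟧ (ℤ.[1+m]⊖[1+n]≡m⊖n m n) ⟩
      ⟦ m ⊖ n ⟧                              ≡⟨ ⊖-homo m n ⟩
      m · 1# + - (n · 1#)                    ≡⟨ cancel (m · 1#) (- (n · 1#)) ⟨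
      (1# + m · 1#) + (- 1# + - (n · 1#))    ≡⟨ cong ((1# + m · 1#) +_) (-‿+-comm 1# (n · 1#)) ⟩
      (1# + m · 1#) + - (1# + n · 1#)        ∎
      where
      cancel : ∀ x y → (1# + x) + (- 1# + y) ≡ x + y
      cancel x y = begin
        (1# + x) + (- 1# + y)   ≡⟨ cong (_+ (- 1# + y)) (+-comm 1# x) ⟩
        (x + 1#) + (- 1# + y)   ≡⟨ +-assoc x 1# _ ⟩
        x + (1# + (- 1# + y))   ≡⟨ cong (x +_) (+-assoc 1# (- 1#) y) ⟨
        x + ((1# + - 1#) + y)   ≡⟨ cong (λ z → x + (z + y)) (-‿inverseʳ 1#) ⟩
        x + (0# + y)            ≡⟨ cong (x +_) (+-identityˡ y) ⟩
        x + y                   ∎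

    +-homo : ∀ i j → ⟦ i ℤ.+ j ⟧ ≡ ⟦ i ⟧ + ⟦ j ⟧
    +-homo (ℤ.+ m) (ℤ.+ n) = begin
      ⟦ ℤ.+ (m ℕ.+ n) ⟧          ≡⟨ natural≡·1# (m ℕ.+ n) ⟩
      (m ℕ.+ n) · 1#           ≡⟨ ×-homo-+ 1# m n ⟩
      m · 1# + n · 1#          ≡⟨ cong₂ _+_ (natural≡·1# m) (natural≡·1# n) ⟨
      ⟦ ℤ.+ m ⟧ + ⟦ ℤ.+ n ⟧        ∎
    +-homo (ℤ.+ m) -[1+ n ] =
      trans (⊖-homo m (suc n)) (sym (cong₂ _+_ (natural≡·1# m) (⟦-⟧ n)))
    +-homo -[1+ m ] (ℤ.+ n) =
      trans (⊖-homo n (suc m)) (trans (+-comm _ _) (sym (cong₂ _+_ (⟦-⟧ m) (natural≡·1# n))))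
    +-homo -[1+ m ] -[1+ n ] = begin
      ⟦ -[1+ suc (m ℕ.+ n) ] ⟧                  ≡⟨ ⟦-⟧ (suc (m ℕ.+ n)) ⟩
      - (suc (suc (m ℕ.+ n)) · 1#)              ≡⟨ cong (λ k → - (k · 1#)) (cong suc (ℕ.+-suc m n)) ⟨
      - ((suc m ℕ.+ suc n) · 1#)                ≡⟨ cong -_ (×-homo-+ 1# (suc m) (suc n)) ⟩
      - (suc m · 1# + suc n · 1#)               ≡⟨ -‿+-comm _ _ ⟨
      - (suc m · 1#) + - (suc n · 1#)           ≡⟨ cong₂ _+_ (⟦-⟧ m) (⟦-⟧ n) ⟨
      ⟦ -[1+ m ] ⟧ + ⟦ -[1+ n ] ⟧               ∎

    -‿homo : ∀ i → ⟦ ℤ.- i ⟧ ≡ - ⟦ i ⟧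
    -‿homo (ℤ.+ zero)  = sym -0#≈0#
    -‿homo (ℤ.+ suc n) = refl
    -‿homo -[1+ n ]    = sym (-‿involutive _)

    ℤ-rawRing : RawRing _ _
    ℤ-rawRing = record
      { Carrier = ℤ ; _≈_ = _≡_ ; _+_ = ℤ._+_ ; _*_ = ℤ._*_ ; -_ = ℤ.-_ ; 0# = ℤ.+ 0 ; 1# = ℤ.+ 1 }

    almostCommutativeRing : ACR.AlmostCommutativeRing _ _
    almostCommutativeRing = ACR.fromCommutativeRing R

    ℤ-morphism : ℤ-rawRing ACR.-Raw-AlmostCommutative⟶ almostCommutativeRing
    ℤ-morphism = record
      { ⟦_⟧ = ⟦_⟧ ; +-homo = +-homo ; *-homo = *-homo ; -‿homo = -‿homo
      ; 0-homo = refl ; 1-homo = refl }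

    ⟦⟧-dec : ∀ i j → Maybe (⟦ i ⟧ ≡ ⟦ j ⟧)
    ⟦⟧-dec i j with i ℤ.≟ j
    ... | yes refl = just refl
    ... | no _     = nothing

  open Algebra.Solver.Ring ℤ-rawRing almostCommutativeRing ℤ-morphism ⟦⟧-dec public
    using (solve; _:=_; _:+_; _:*_; :-_; con)

n+e+e≤n⇒e≡0 : ∀ n e → n ℕ.+ e ℕ.+ e ≤ n → e ≡ 0
n+e+e≤n⇒e≡0 n e n+e+e≤n = ℕ.n≤0⇒n≡0 (ℕ.+-cancelˡ-≤ n e 0
  (subst (n ℕ.+ e ≤_) (sym (ℕ.+-identityʳ n)) (ℕ.m+n≤o⇒m≤o (n ℕ.+ e) n+e+e≤n)))

cong₃ : ∀ {a} {A B C D : Set a} (f : A → B → C → D) {x x′ y y′ z z′} →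
        x ≡ x′ → y ≡ y′ → z ≡ z′ → f x y z ≡ f x′ y′ z′
cong₃ f refl refl refl = refl

balanced⇒even : ∀ a c e g → a ℕ.+ e ℕ.+ e ≡ c ℕ.+ g ℕ.+ g → (a ℕ.+ c) % 2 ≡ 0
balanced⇒even a c e g balanced = begin
  (a ℕ.+ c) % 2                  ≡⟨ [m+kn]%n≡m%n (a ℕ.+ c) e 2 ⟨
  (a ℕ.+ c ℕ.+ e ℕ.* 2) % 2      ≡⟨ cong (_% 2) (begin
    a ℕ.+ c ℕ.+ e ℕ.* 2          ≡⟨ shuffle a c e ⟩
    a ℕ.+ e ℕ.+ e ℕ.+ c          ≡⟨ cong (ℕ._+ c) balanced ⟩
    c ℕ.+ g ℕ.+ g ℕ.+ c          ≡⟨ double c g ⟩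
    (c ℕ.+ g) ℕ.* 2              ∎) ⟩
  ((c ℕ.+ g) ℕ.* 2) % 2          ≡⟨ m*n%n≡0 (c ℕ.+ g) 2 ⟩
  0                              ∎
  where
  open ≡-Reasoning
  shuffle : ∀ a c e → a ℕ.+ c ℕ.+ e ℕ.* 2 ≡ a ℕ.+ e ℕ.+ e ℕ.+ c
  shuffle = solve-∀
  double : ∀ c g → c ℕ.+ g ℕ.+ g ℕ.+ c ≡ (c ℕ.+ g) ℕ.* 2
  double = solve-∀

module AutomorphismsOverFiniteField (𝔽 : FiniteField) where
  open FiniteField 𝔽
  open Over 𝔽
  open IntegerCoefficientSolver isCommutativeRing

  private
    ring : CommutativeRing _ _
    ring = record { isCommutativeRing = isCommutativeRing }
  open CommutativeRing ring
    using (+-identityˡ; +-identityʳ; +-comm; -‿inverseʳ;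
           *-identityˡ; *-identityʳ; *-assoc; *-comm; zeroˡ; zeroʳ; semiring)
  open import Algebra.Properties.Ring (CommutativeRing.ring ring)
    using (-0#≈0#; -‿involutive; -1*x≈-x; x∙y⁻¹≈ε⇒x≈y; x≈y⇒x∙y⁻¹≈ε; +-inverseˡ-unique; +-inverseʳ-unique)
  open import Algebra.Properties.Semiring.Mult semiring using (×1-homo-*) renaming (_×_ to _·_)
  open ≡-Reasoning

  x*y≡0⇒y≡0 : ∀ {x y} → x ≢ 0# → x * y ≡ 0# → y ≡ 0#
  x*y≡0⇒y≡0 {x} {y} x≢0 xy≡0 = begin
    y                      ≡⟨ *-identityˡ y ⟨
    1# * y                 ≡⟨ cong (_* y) (⁻¹-inverse x x≢0) ⟨
    x * x ⁻¹ * y           ≡⟨ solve 3 (λ x x⁻¹ y → x :* x⁻¹ :* y := x⁻¹ :* (x :* y)) refl x (x ⁻¹) y ⟩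
    x ⁻¹ * (x * y)         ≡⟨ cong (x ⁻¹ *_) xy≡0 ⟩
    x ⁻¹ * 0#              ≡⟨ zeroʳ _ ⟩
    0#                     ∎

  *-≢0 : ∀ {x y} → x ≢ 0# → y ≢ 0# → x * y ≢ 0#
  *-≢0 x≢0 y≢0 xy≡0 = y≢0 (x*y≡0⇒y≡0 x≢0 xy≡0)

  *-cancelˡ : ∀ {z x y} → z ≢ 0# → z * x ≡ z * y → x ≡ y
  *-cancelˡ {z} {x} {y} z≢0 zx≡zy = x∙y⁻¹≈ε⇒x≈y x y (x*y≡0⇒y≡0 z≢0 (begin
    z * (x + - y)          ≡⟨ solve 3 (λ z x y → z :* (x :+ :- y) := z :* x :+ :- (z :* y)) refl z x y ⟩
    z * x + - (z * y)      ≡⟨ x≈y⇒x∙y⁻¹≈ε zx≡zy ⟩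
    0#                     ∎))

  ⁻¹-≢0 : ∀ {x} → x ≢ 0# → x ⁻¹ ≢ 0#
  ⁻¹-≢0 {x} x≢0 x⁻¹≡0 = 0≢1 (begin
    0#          ≡⟨ zeroʳ x ⟨
    x * 0#      ≡⟨ cong (x *_) x⁻¹≡0 ⟨
    x * x ⁻¹    ≡⟨ ⁻¹-inverse x x≢0 ⟩
    1#          ∎)

  -‿≢0 : ∀ {x} → x ≢ 0# → - x ≢ 0#
  -‿≢0 {x} x≢0 -x≡0 = x≢0 (trans (sym (-‿involutive x)) (trans (cong -_ -x≡0) -0#≈0#))

  1≢0 : 1# ≢ 0#
  1≢0 1≡0 = 0≢1 (sym 1≡0)

  x*x≡1⇒x≡±1 : ∀ {x} → x * x ≡ 1# → x ≡ 1# ⊎ x ≡ - 1#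
  x*x≡1⇒x≡±1 {x} xx≡1 with (x + - 1#) ≟ 0#
  ... | yes x-1≡0 = inj₁ (x∙y⁻¹≈ε⇒x≈y x 1# x-1≡0)
  ... | no  x-1≢0 = inj₂ (+-inverseʳ-unique 1# x (trans (+-comm 1# x) (x*y≡0⇒y≡0 x-1≢0 (begin
    (x + - 1#) * (x + 1#)  ≡⟨ solve 1 (λ x → (x :+ :- con (ℤ.+ 1)) :* (x :+ con (ℤ.+ 1)) := x :* x :+ :- con (ℤ.+ 1)) refl x ⟩
    x * x + - 1#           ≡⟨ x≈y⇒x∙y⁻¹≈ε xx≡1 ⟩
    0#                     ∎))))

  2# : Carrier
  2# = 1# + 1#

  natToF≡·1# : ∀ n → natToF n ≡ n · 1#
  natToF≡·1# zero    = refl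
  natToF≡·1# (suc n) = cong (1# +_) (natToF≡·1# n)

  prime⇒odd : ∀ {p} → Prime p → 3 ≤ p → ∃[ k ] p ≡ suc (k ℕ.* 2)
  prime⇒odd {p} p-prime 3≤p with p % 2 | m≡m%n+[m/n]*n p 2 | m%n<n p 2
  ... | 0 | p≡2k | _ with prime⇒irreducible p-prime (divides (p / 2) p≡2k)
  ...   | inj₁ ()
  ...   | inj₂ refl with 3≤p
  ...     | s≤s (s≤s ())
  prime⇒odd {p} p-prime 3≤p | 1 | p≡1+2k | _ = p / 2 , p≡1+2k
  prime⇒odd {p} p-prime 3≤p | suc (suc _) | _ | s≤s (s≤s ())

  odd-characteristic⇒2≢0 : ∀ {p} → Prime p → 3 ≤ p → natToF p ≡ 0# → 2# ≢ 0#
  odd-characteristic⇒2≢0 {p} p-prime 3≤p p≡0 2≡0 with prime⇒odd p-prime 3≤p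
  ... | k , refl = 1≢0 (begin
    1#                          ≡⟨ +-identityʳ 1# ⟨
    1# + 0#                     ≡⟨ cong (1# +_) (zeroʳ (k · 1#)) ⟨
    1# + k · 1# * 0#            ≡⟨ cong (λ z → 1# + k · 1# * z) 2≡0 ⟨
    1# + k · 1# * 2#            ≡⟨ cong (λ z → 1# + k · 1# * (1# + z)) (+-identityʳ 1#) ⟨
    1# + k · 1# * (2 · 1#)      ≡⟨ cong (1# +_) (×1-homo-* k 2) ⟨
    1# + (k ℕ.* 2) · 1#         ≡⟨ natToF≡·1# (suc (k ℕ.* 2)) ⟨
    natToF (suc (k ℕ.* 2))      ≡⟨ p≡0 ⟩
    0#                          ∎)

  coeff : Poly → ℕ → Carrier
  coeff []      _       = 0#
  coeff (a ∷ p) zero    = a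
  coeff (a ∷ p) (suc i) = coeff p i

  infix 4 _≋_
  record _≋_ (p r : Poly) : Set where
    constructor coeffwise
    field coeff-≡ : ∀ i → coeff p i ≡ coeff r i
  open _≋_

  ≋-refl : ∀ {p} → p ≋ p
  ≋-refl = coeffwise λ _ → refl

  ≋-sym : ∀ {p r} → p ≋ r → r ≋ p
  ≋-sym p≋r = coeffwise λ i → sym (coeff-≡ p≋r i)

  ≋-trans : ∀ {p r s} → p ≋ r → r ≋ s → p ≋ s
  ≋-trans p≋r r≋s = coeffwise λ i → trans (coeff-≡ p≋r i) (coeff-≡ r≋s i)

  ∷-≋ : ∀ {a b p r} → a ≡ b → p ≋ r → (a ∷ p) ≋ (b ∷ r)
  ∷-≋ a≡b p≋r = coeffwise λ { zero → a≡b ; (suc i) → coeff-≡ p≋r i }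

  tail-≋ : ∀ {a b p r} → (a ∷ p) ≋ (b ∷ r) → p ≋ r
  tail-≋ e = coeffwise λ i → coeff-≡ e (suc i)

  tail-≋[] : ∀ {a p} → (a ∷ p) ≋ [] → p ≋ []
  tail-≋[] e = coeffwise λ i → coeff-≡ e (suc i)

  0∷-≋[] : ∀ {p} → p ≋ [] → (0# ∷ p) ≋ []
  0∷-≋[] p≋[] = coeffwise λ { zero → refl ; (suc i) → coeff-≡ p≋[] i }

  norm-≋ : ∀ p → norm p ≋ p
  norm-≋ [] = ≋-refl
  norm-≋ (a ∷ p) with norm p | norm-≋ p
  ... | _ ∷ _ | np≋p = ∷-≋ refl np≋p
  ... | []    | []≋p with a ≟ 0#
  ...   | yes a≡0 = coeffwise λ { zero → sym a≡0 ; (suc i) → coeff-≡ []≋p i }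
  ...   | no  _   = ∷-≋ refl []≋p

  ≋[]⇒norm≡[] : ∀ {p} → p ≋ [] → norm p ≡ []
  ≋[]⇒norm≡[] {[]}    _    = refl
  ≋[]⇒norm≡[] {a ∷ p} p≋[] with norm p | ≋[]⇒norm≡[] (tail-≋[] p≋[])
  ... | [] | refl with a ≟ 0#
  ...   | yes _   = refl
  ...   | no  a≢0 = ⊥-elim (a≢0 (coeff-≡ p≋[] 0))

  ≈ₚ⇒≋ : ∀ {p r} → p ≈ₚ r → p ≋ r
  ≈ₚ⇒≋ {p} {r} p≈r = ≋-trans (≋-sym (norm-≋ p)) (≋-trans (coeffwise λ i → cong (λ s → coeff s i) p≈r) (norm-≋ r))

  ≋⇒≈ₚ : ∀ {p r} → p ≋ r → p ≈ₚ r
  ≋⇒≈ₚ {[]}    {r}     p≋r = sym (≋[]⇒norm≡[] (≋-sym p≋r))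
  ≋⇒≈ₚ {a ∷ p} {[]}    p≋r = ≋[]⇒norm≡[] p≋r
  ≋⇒≈ₚ {a ∷ p} {b ∷ r} p≋r with coeff-≡ p≋r 0
  ... | refl with norm p | norm r | ≋⇒≈ₚ {p} {r} (tail-≋ p≋r)
  ...   | _ ∷ _ | _ | refl = refl
  ...   | []    | _ | refl with a ≟ 0#
  ...     | yes _ = refl
  ...     | no  _ = refl

  coeff-+ₚ : ∀ p r i → coeff (p +ₚ r) i ≡ coeff p i + coeff r i
  coeff-+ₚ []      r       i       = sym (+-identityˡ _)
  coeff-+ₚ (a ∷ p) []      i       = sym (+-identityʳ _)
  coeff-+ₚ (a ∷ p) (b ∷ r) zero    = refl
  coeff-+ₚ (a ∷ p) (b ∷ r) (suc i) = coeff-+ₚ p r i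

  coeff-negₚ : ∀ p i → coeff (negₚ p) i ≡ - coeff p i
  coeff-negₚ []      i       = sym -0#≈0#
  coeff-negₚ (a ∷ p) zero    = refl
  coeff-negₚ (a ∷ p) (suc i) = coeff-negₚ p i

  coeff--ₚ : ∀ p r i → coeff (p -ₚ r) i ≡ coeff p i + - coeff r i
  coeff--ₚ p r i = trans (coeff-+ₚ p (negₚ r) i) (cong (coeff p i +_) (coeff-negₚ r i))

  coeff-scale : ∀ c p i → coeff (scale c p) i ≡ c * coeff p i
  coeff-scale c []      i       = sym (zeroʳ c)
  coeff-scale c (a ∷ p) zero    = refl
  coeff-scale c (a ∷ p) (suc i) = coeff-scale c p i

  coeff-∷*ₚ : ∀ a p r i → coeff ((a ∷ p) *ₚ r) i ≡ a * coeff r i + coeff (0# ∷ (p *ₚ r)) i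
  coeff-∷*ₚ a p r i = trans (coeff-+ₚ (scale a r) _ i) (cong (_+ _) (coeff-scale a r i))

  coeff-const*ₚ : ∀ x p i → coeff (const x *ₚ p) i ≡ x * coeff p i
  coeff-const*ₚ x p zero    = trans (coeff-∷*ₚ x [] p zero) (+-identityʳ _)
  coeff-const*ₚ x p (suc i) = trans (coeff-∷*ₚ x [] p (suc i)) (+-identityʳ _)

  coeff-*ₚconst : ∀ p x i → coeff (p *ₚ const x) i ≡ coeff p i * x
  coeff-*ₚconst []      x i       = sym (zeroˡ x)
  coeff-*ₚconst (a ∷ p) x zero    = trans (coeff-∷*ₚ a p (const x) zero) (+-identityʳ _)
  coeff-*ₚconst (a ∷ p) x (suc i) = begin
    coeff ((a ∷ p) *ₚ const x) (suc i)   ≡⟨ coeff-∷*ₚ a p (const x) (suc i) ⟩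
    a * 0# + coeff (p *ₚ const x) i      ≡⟨ cong₂ _+_ (zeroʳ a) (coeff-*ₚconst p x i) ⟩
    0# + coeff p i * x                   ≡⟨ +-identityˡ _ ⟩
    coeff p i * x                        ∎

  +ₚ-cong : ∀ {p p′ r r′} → p ≋ p′ → r ≋ r′ → p +ₚ r ≋ p′ +ₚ r′
  +ₚ-cong {p} {p′} {r} {r′} p≋p′ r≋r′ = coeffwise λ i → begin
    coeff (p +ₚ r) i          ≡⟨ coeff-+ₚ p r i ⟩
    coeff p i + coeff r i     ≡⟨ cong₂ _+_ (coeff-≡ p≋p′ i) (coeff-≡ r≋r′ i) ⟩
    coeff p′ i + coeff r′ i   ≡⟨ coeff-+ₚ p′ r′ i ⟨
    coeff (p′ +ₚ r′) i        ∎

  *ₚ-congˡ : ∀ p {r r′} → r ≋ r′ → p *ₚ r ≋ p *ₚ r′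
  *ₚ-congˡ []      r≋r′ = ≋-refl
  *ₚ-congˡ (a ∷ p) {r} {r′} r≋r′ = coeffwise λ i → begin
    coeff ((a ∷ p) *ₚ r) i                       ≡⟨ coeff-∷*ₚ a p r i ⟩
    a * coeff r i + coeff (0# ∷ (p *ₚ r)) i      ≡⟨ cong₂ (λ x y → a * x + y) (coeff-≡ r≋r′ i)
                                                      (coeff-≡ (∷-≋ refl (*ₚ-congˡ p r≋r′)) i) ⟩
    a * coeff r′ i + coeff (0# ∷ (p *ₚ r′)) i    ≡⟨ coeff-∷*ₚ a p r′ i ⟨
    coeff ((a ∷ p) *ₚ r′) i                      ∎

  *ₚ-zeroʳ : ∀ p → p *ₚ [] ≋ []
  *ₚ-zeroʳ []      = ≋-refl
  *ₚ-zeroʳ (a ∷ p) = coeffwise λ i → begin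
    coeff ((a ∷ p) *ₚ []) i                 ≡⟨ coeff-∷*ₚ a p [] i ⟩
    a * 0# + coeff (0# ∷ (p *ₚ [])) i       ≡⟨ cong₂ _+_ (zeroʳ a) (coeff-≡ (0∷-≋[] (*ₚ-zeroʳ p)) i) ⟩
    0# + 0#                                 ≡⟨ +-identityʳ 0# ⟩
    0#                                      ∎

  *ₚ-zeroˡ : ∀ {p} → p ≋ [] → ∀ r → p *ₚ r ≋ []
  *ₚ-zeroˡ {[]}    p≋[] r = ≋-refl
  *ₚ-zeroˡ {a ∷ p} p≋[] r = coeffwise λ i → begin
    coeff ((a ∷ p) *ₚ r) i                  ≡⟨ coeff-∷*ₚ a p r i ⟩
    a * coeff r i + coeff (0# ∷ (p *ₚ r)) i ≡⟨ cong₂ (λ x y → x * coeff r i + y) (coeff-≡ p≋[] 0)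
                                                 (coeff-≡ (0∷-≋[] (*ₚ-zeroˡ (tail-≋[] p≋[]) r)) i) ⟩
    0# * coeff r i + 0#                     ≡⟨ cong (_+ 0#) (zeroˡ _) ⟩
    0# + 0#                                 ≡⟨ +-identityʳ 0# ⟩
    0#                                      ∎

  *ₚ-congʳ : ∀ {p p′} → p ≋ p′ → ∀ r → p *ₚ r ≋ p′ *ₚ r
  *ₚ-congʳ {[]}    {p′}     p≋p′ r = ≋-sym (*ₚ-zeroˡ (≋-sym p≋p′) r)
  *ₚ-congʳ {a ∷ p} {[]}     p≋p′ r = *ₚ-zeroˡ p≋p′ r
  *ₚ-congʳ {a ∷ p} {b ∷ p′} p≋p′ r = coeffwise λ i → begin
    coeff ((a ∷ p) *ₚ r) i                    ≡⟨ coeff-∷*ₚ a p r i ⟩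
    a * coeff r i + coeff (0# ∷ (p *ₚ r)) i   ≡⟨ cong₂ (λ x y → x * coeff r i + y) (coeff-≡ p≋p′ 0)
                                                   (coeff-≡ (∷-≋ refl (*ₚ-congʳ (tail-≋ p≋p′) r)) i) ⟩
    b * coeff r i + coeff (0# ∷ (p′ *ₚ r)) i  ≡⟨ coeff-∷*ₚ b p′ r i ⟨
    coeff ((b ∷ p′) *ₚ r) i                   ∎

  *ₚ-cong : ∀ {p p′ r r′} → p ≋ p′ → r ≋ r′ → p *ₚ r ≋ p′ *ₚ r′
  *ₚ-cong {p′ = p′} p≋p′ r≋r′ = ≋-trans (*ₚ-congʳ p≋p′ _) (*ₚ-congˡ p′ r≋r′)

  *ₚ-≋[] : ∀ p {r} → r ≋ [] → p *ₚ r ≋ []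
  *ₚ-≋[] p r≋[] = ≋-trans (*ₚ-congˡ p r≋[]) (*ₚ-zeroʳ p)

  infix 4 _≤ᵈ_
  _≤ᵈ_ : Poly → ℕ → Set
  p ≤ᵈ d = ∀ i → d < i → coeff p i ≡ 0#

  HasDegree : Poly → ℕ → Set
  HasDegree p d = p ≤ᵈ d × coeff p d ≢ 0#

  ≤ᵈ-vanishes : ∀ {p d} → p ≤ᵈ d → coeff p d ≡ 0# → ∀ i → d ≤ i → coeff p i ≡ 0#
  ≤ᵈ-vanishes p≤d pd≡0 i d≤i with ℕ.m≤n⇒m<n∨m≡n d≤i
  ... | inj₁ d<i  = p≤d i d<i
  ... | inj₂ refl = pd≡0

  ≤ᵈ0⇒const : ∀ {p} → p ≤ᵈ 0 → p ≋ const (coeff p 0)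
  ≤ᵈ0⇒const p≤0 = coeffwise λ { zero → refl ; (suc i) → p≤0 (suc i) (s≤s z≤n) }

  zero⊎degree : ∀ p → p ≋ [] ⊎ ∃ (HasDegree p)
  zero⊎degree [] = inj₁ ≋-refl
  zero⊎degree (a ∷ p) with zero⊎degree p
  ... | inj₂ (d , p≤d , pd≢0) = inj₂ (suc d , (λ { zero () ; (suc i) (s≤s d<i) → p≤d i d<i }) , pd≢0)
  ... | inj₁ p≋[] with a ≟ 0#
  ...   | yes a≡0 = inj₁ (coeffwise λ { zero → a≡0 ; (suc i) → coeff-≡ p≋[] i })
  ...   | no  a≢0 = inj₂ (0 , (λ { zero () ; (suc i) _ → coeff-≡ p≋[] i }) , a≢0)

  *ₚ-leading : ∀ p r {d e} → p ≤ᵈ d → r ≤ᵈ e →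
               p *ₚ r ≤ᵈ d ℕ.+ e × coeff (p *ₚ r) (d ℕ.+ e) ≡ coeff p d * coeff r e
  *ₚ-leading []      r p≤d r≤e = (λ _ _ → refl) , sym (zeroˡ _)
  *ₚ-leading (a ∷ p) r {zero} {e} p≤0 r≤e = bound , leading
    where
    pr≋[] : 0# ∷ (p *ₚ r) ≋ []
    pr≋[] = 0∷-≋[] (*ₚ-zeroˡ {p} (coeffwise λ i → p≤0 (suc i) (s≤s z≤n)) r)
    bound : (a ∷ p) *ₚ r ≤ᵈ e
    bound i e<i = begin
      coeff ((a ∷ p) *ₚ r) i                   ≡⟨ coeff-∷*ₚ a p r i ⟩
      a * coeff r i + coeff (0# ∷ (p *ₚ r)) i  ≡⟨ cong₂ (λ x y → a * x + y) (r≤e i e<i) (coeff-≡ pr≋[] i) ⟩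
      a * 0# + 0#                              ≡⟨ trans (+-identityʳ _) (zeroʳ a) ⟩
      0#                                       ∎
    leading : coeff ((a ∷ p) *ₚ r) e ≡ a * coeff r e
    leading = trans (coeff-∷*ₚ a p r e) (trans (cong (a * coeff r e +_) (coeff-≡ pr≋[] e)) (+-identityʳ _))
  *ₚ-leading (a ∷ p) r {suc d} {e} p≤d r≤e = bound , leading
    where
    ih : p *ₚ r ≤ᵈ d ℕ.+ e × coeff (p *ₚ r) (d ℕ.+ e) ≡ coeff p d * coeff r e
    ih = *ₚ-leading p r (λ i d<i → p≤d (suc i) (s≤s d<i)) r≤e
    r-vanishes : ∀ i → d ℕ.+ e < i → coeff r (suc i) ≡ 0#
    r-vanishes i d+e<i = r≤e (suc i) (s≤s (ℕ.≤-trans (ℕ.m≤n+m e d) (ℕ.<⇒≤ d+e<i)))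
    bound : (a ∷ p) *ₚ r ≤ᵈ suc d ℕ.+ e
    bound zero ()
    bound (suc i) (s≤s d+e<i) = begin
      coeff ((a ∷ p) *ₚ r) (suc i)       ≡⟨ coeff-∷*ₚ a p r (suc i) ⟩
      a * coeff r (suc i) + coeff (p *ₚ r) i ≡⟨ cong₂ (λ x y → a * x + y) (r-vanishes i d+e<i) (proj₁ ih i d+e<i) ⟩
      a * 0# + 0#                        ≡⟨ trans (+-identityʳ _) (zeroʳ a) ⟩
      0#                                 ∎
    leading : coeff ((a ∷ p) *ₚ r) (suc d ℕ.+ e) ≡ coeff p d * coeff r e
    leading = begin
      coeff ((a ∷ p) *ₚ r) (suc (d ℕ.+ e))             ≡⟨ coeff-∷*ₚ a p r (suc (d ℕ.+ e)) ⟩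
      a * coeff r (suc (d ℕ.+ e)) + coeff (p *ₚ r) (d ℕ.+ e)
        ≡⟨ cong₂ (λ x y → a * x + y) (r≤e _ (s≤s (ℕ.m≤n+m e d))) (proj₂ ih) ⟩
      a * 0# + coeff p d * coeff r e                   ≡⟨ cong (_+ coeff p d * coeff r e) (zeroʳ a) ⟩
      0# + coeff p d * coeff r e                       ≡⟨ +-identityˡ _ ⟩
      coeff p d * coeff r e                            ∎

  ≋[]⇒size≡0 : ∀ {p} → p ≋ [] → size p ≡ 0
  ≋[]⇒size≡0 p≋[] = cong length (≋[]⇒norm≡[] p≋[])

  degree⇒size,sgn : ∀ {p d} → HasDegree p d → size p ≡ suc d × sgn p ≡ coeff p d
  degree⇒size,sgn {[]} (_ , p0≢0) = ⊥-elim (p0≢0 refl)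
  degree⇒size,sgn {a ∷ p} {zero} (p≤0 , a≢0) with norm p | ≋[]⇒norm≡[] {p} (coeffwise λ i → p≤0 (suc i) (s≤s z≤n))
  ... | [] | refl with a ≟ 0#
  ...   | yes a≡0 = ⊥-elim (a≢0 a≡0)
  ...   | no  _   = refl , refl
  degree⇒size,sgn {a ∷ p} {suc d} (p≤d , pd≢0) with norm p | degree⇒size,sgn {p} {d} ((λ i d<i → p≤d (suc i) (s≤s d<i)) , pd≢0)
  ... | _ ∷ _ | size≡ , sgn≡ = cong suc size≡ , sgn≡

  const-support : ∀ {u} n → coeff (const u) n ≢ 0# → n ≡ 0
  const-support zero    _       = refl
  const-support (suc n) un≢0    = ⊥-elim (un≢0 refl)

  *ₚ≋const⇒const : ∀ p r {u} → p *ₚ r ≋ const u → u ≢ 0# →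
                   p ≋ const (coeff p 0) × r ≋ const (coeff r 0) × coeff p 0 * coeff r 0 ≡ u
  *ₚ≋const⇒const p r pr≋u u≢0 with zero⊎degree p | zero⊎degree r
  ... | inj₁ p≋[] | _ = ⊥-elim (u≢0 (trans (sym (coeff-≡ pr≋u 0)) (coeff-≡ (*ₚ-zeroˡ p≋[] r) 0)))
  ... | inj₂ _ | inj₁ r≋[] =
    ⊥-elim (u≢0 (trans (sym (coeff-≡ pr≋u 0)) (coeff-≡ (*ₚ-≋[] p r≋[]) 0)))
  ... | inj₂ (d , p≤d , pd≢0) | inj₂ (e , r≤e , re≢0)
    with const-support (d ℕ.+ e) (λ ≡0 → *-≢0 pd≢0 re≢0
           (trans (sym (proj₂ (*ₚ-leading p r p≤d r≤e))) (trans (coeff-≡ pr≋u (d ℕ.+ e)) ≡0)))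
  ... | d+e≡0 with ℕ.m+n≡0⇒m≡0 d d+e≡0 | ℕ.m+n≡0⇒n≡0 d d+e≡0
  ... | refl | refl = ≤ᵈ0⇒const p≤d , ≤ᵈ0⇒const r≤e ,
                      trans (sym (proj₂ (*ₚ-leading p r p≤d r≤e))) (coeff-≡ pr≋u 0)

  unit⇒degree0 : ∀ {p d} → HasDegree p d → IsUnit p → d ≡ 0
  unit⇒degree0 {p} {d} (_ , pd≢0) (k , pk≈1) =
    const-support d (λ ≡0 → pd≢0 (trans (coeff-≡ p≋const d) ≡0))
    where
    p≋const : p ≋ const (coeff p 0)
    p≋const = proj₁ (*ₚ≋const⇒const p k (≈ₚ⇒≋ pk≈1) 1≢0)

  ≋-≤ᵈ : ∀ {p r d} → p ≋ r → r ≤ᵈ d → p ≤ᵈ d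
  ≋-≤ᵈ p≋r r≤d i d<i = trans (coeff-≡ p≋r i) (r≤d i d<i)

  coeff≢0⇒≤ : ∀ {p d n} → p ≤ᵈ d → coeff p n ≢ 0# → n ≤ d
  coeff≢0⇒≤ {d = d} {n} p≤d pn≢0 with n ℕ.≤? d
  ... | yes n≤d = n≤d
  ... | no  n≰d = ⊥-elim (pn≢0 (p≤d n (ℕ.≰⇒> n≰d)))

  coeff-*ₚ≋const : ∀ p {r x} → r ≋ const x → ∀ i → coeff (p *ₚ r) i ≡ coeff p i * x
  coeff-*ₚ≋const p {r} {x} r≋x i = trans (coeff-≡ (*ₚ-congˡ p r≋x) i) (coeff-*ₚconst p x i)

  value : Form → Poly → Poly → Poly
  value (form A B C) x y = A *ₚ x *ₚ x +ₚ B *ₚ x *ₚ y +ₚ C *ₚ y *ₚ y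

  coeff-value : ∀ A B C x y i → coeff (value (form A B C) x y) i
              ≡ coeff (A *ₚ x *ₚ x) i + coeff (B *ₚ x *ₚ y) i + coeff (C *ₚ y *ₚ y) i
  coeff-value A B C x y i =
    trans (coeff-+ₚ (A *ₚ x *ₚ x +ₚ B *ₚ x *ₚ y) _ i) (cong (_+ _) (coeff-+ₚ (A *ₚ x *ₚ x) _ i))

  *ₚ-leading³ : ∀ P x y {d e g} → P ≤ᵈ d → x ≤ᵈ e → y ≤ᵈ g →
                P *ₚ x *ₚ y ≤ᵈ d ℕ.+ e ℕ.+ g × coeff (P *ₚ x *ₚ y) (d ℕ.+ e ℕ.+ g) ≡ coeff P d * coeff x e * coeff y g
  *ₚ-leading³ P x y P≤d x≤e y≤g with *ₚ-leading P x P≤d x≤e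
  ... | Px≤ , Px-lead with *ₚ-leading (P *ₚ x) y Px≤ y≤g
  ...   | Pxy≤ , Pxy-lead = Pxy≤ , trans Pxy-lead (cong (_* _) Px-lead)

  module ValueDegree (A B C : Poly) {a c : ℕ}
    (A-degree : HasDegree A a) (C-degree : HasDegree C c) (a≤c : a ≤ c)
    (B-small : ∀ i → a ≤ i → coeff B i ≡ 0#)
    (no-cancellation : ∀ {e g s t} → s ≢ 0# → t ≢ 0# → a ℕ.+ e ℕ.+ e ≡ c ℕ.+ g ℕ.+ g →
                       coeff A a * s * s + coeff C c * t * t ≢ 0#)
    where

    private
      f : Form
      f = form A B C

      square-term≢0 : ∀ {P s} → P ≢ 0# → s ≢ 0# → P * s * s ≢ 0#
      square-term≢0 P≢0 s≢0 = *-≢0 (*-≢0 P≢0 s≢0) s≢0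

      middle-vanishes : ∀ {x y e g} → x ≤ᵈ e → y ≤ᵈ g → ∀ i → a ℕ.+ e ℕ.+ g ≤ i → coeff (B *ₚ x *ₚ y) i ≡ 0#
      middle-vanishes {x} {y} {e} {g} x≤e y≤g = ≤ᵈ-vanishes {B *ₚ x *ₚ y} (proj₁ lead) (begin
        coeff (B *ₚ x *ₚ y) (a ℕ.+ e ℕ.+ g)  ≡⟨ proj₂ lead ⟩
        coeff B a * coeff x e * coeff y g    ≡⟨ cong (λ z → z * coeff x e * coeff y g) (B-small a ℕ.≤-refl) ⟩
        0# * coeff x e * coeff y g           ≡⟨ trans (cong (_* coeff y g) (zeroˡ _)) (zeroˡ _) ⟩
        0#                                   ∎)
        where
        lead : B *ₚ x *ₚ y ≤ᵈ a ℕ.+ e ℕ.+ g × coeff (B *ₚ x *ₚ y) (a ℕ.+ e ℕ.+ g) ≡ coeff B a * coeff x e * coeff y g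
        lead = *ₚ-leading³ B x y (λ i a<i → B-small i (ℕ.<⇒≤ a<i)) x≤e y≤g

      middle≤ : ∀ {e g N} → a ℕ.+ e ℕ.+ e ≤ N → c ℕ.+ g ℕ.+ g ≤ N → a ℕ.+ e ℕ.+ g ≤ N
      middle≤ {e} {g} x≤N y≤N with ℕ.≤-total e g
      ... | inj₁ e≤g = ℕ.≤-trans (ℕ.+-monoˡ-≤ g (ℕ.+-mono-≤ a≤c e≤g)) y≤N
      ... | inj₂ g≤e = ℕ.≤-trans (ℕ.+-monoʳ-≤ (a ℕ.+ e) g≤e) x≤N

      outer-terms : ∀ {x y e g N} → x ≤ᵈ e → y ≤ᵈ g → a ℕ.+ e ℕ.+ e ≤ N → c ℕ.+ g ℕ.+ g ≤ N →
                    coeff (value f x y) N ≡ coeff (A *ₚ x *ₚ x) N + coeff (C *ₚ y *ₚ y) N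
      outer-terms {x} {y} {N = N} x≤e y≤g x≤N y≤N = begin
        coeff (value f x y) N                                            ≡⟨ coeff-value A B C x y N ⟩
        coeff (A *ₚ x *ₚ x) N + coeff (B *ₚ x *ₚ y) N + coeff (C *ₚ y *ₚ y) N
          ≡⟨ cong (λ z → coeff (A *ₚ x *ₚ x) N + z + coeff (C *ₚ y *ₚ y) N) (middle-vanishes x≤e y≤g N (middle≤ x≤N y≤N)) ⟩
        coeff (A *ₚ x *ₚ x) N + 0# + coeff (C *ₚ y *ₚ y) N               ≡⟨ cong (_+ coeff (C *ₚ y *ₚ y) N) (+-identityʳ _) ⟩
        coeff (A *ₚ x *ₚ x) N + coeff (C *ₚ y *ₚ y) N                    ∎

    value-top : ∀ {x y e g} → HasDegree x e → HasDegree y g →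
                ∃[ N ] a ℕ.+ e ℕ.+ e ≤ N × c ℕ.+ g ℕ.+ g ≤ N × coeff (value f x y) N ≢ 0#
    value-top {x} {y} {e} {g} (x≤e , xe≢0) (y≤g , yg≢0)
      with *ₚ-leading³ A x x (proj₁ A-degree) x≤e x≤e | *ₚ-leading³ C y y (proj₁ C-degree) y≤g y≤g
         | ℕ.<-cmp (a ℕ.+ e ℕ.+ e) (c ℕ.+ g ℕ.+ g)
    ... | Axx≤ , Axx-lead | Cyy≤ , Cyy-lead | tri< x<y _ _ =
      _ , ℕ.<⇒≤ x<y , ℕ.≤-refl , λ ≡0 → square-term≢0 (proj₂ C-degree) yg≢0 (begin
        coeff C c * coeff y g * coeff y g       ≡⟨ Cyy-lead ⟨
        coeff (C *ₚ y *ₚ y) _                   ≡⟨ +-identityˡ _ ⟨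
        0# + coeff (C *ₚ y *ₚ y) _              ≡⟨ cong (_+ _) (Axx≤ _ x<y) ⟨
        coeff (A *ₚ x *ₚ x) _ + coeff (C *ₚ y *ₚ y) _  ≡⟨ outer-terms x≤e y≤g (ℕ.<⇒≤ x<y) ℕ.≤-refl ⟨
        coeff (value f x y) _                   ≡⟨ ≡0 ⟩
        0#                                      ∎)
    ... | Axx≤ , Axx-lead | Cyy≤ , Cyy-lead | tri> _ _ y<x =
      _ , ℕ.≤-refl , ℕ.<⇒≤ y<x , λ ≡0 → square-term≢0 (proj₂ A-degree) xe≢0 (begin
        coeff A a * coeff x e * coeff x e       ≡⟨ Axx-lead ⟨
        coeff (A *ₚ x *ₚ x) _                   ≡⟨ +-identityʳ _ ⟨
        coeff (A *ₚ x *ₚ x) _ + 0#              ≡⟨ cong (_ +_) (Cyy≤ _ y<x) ⟨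
        coeff (A *ₚ x *ₚ x) _ + coeff (C *ₚ y *ₚ y) _  ≡⟨ outer-terms x≤e y≤g ℕ.≤-refl (ℕ.<⇒≤ y<x) ⟨
        coeff (value f x y) _                   ≡⟨ ≡0 ⟩
        0#                                      ∎)
    ... | Axx≤ , Axx-lead | Cyy≤ , Cyy-lead | tri≈ _ x≡y _ =
      _ , ℕ.≤-refl , ℕ.≤-reflexive (sym x≡y) , λ ≡0 → no-cancellation xe≢0 yg≢0 x≡y (begin
        coeff A a * coeff x e * coeff x e + coeff C c * coeff y g * coeff y g
          ≡⟨ cong₂ _+_ Axx-lead (trans (cong (coeff (C *ₚ y *ₚ y)) x≡y) Cyy-lead) ⟨
        coeff (A *ₚ x *ₚ x) _ + coeff (C *ₚ y *ₚ y) _  ≡⟨ outer-terms x≤e y≤g ℕ.≤-refl (ℕ.≤-reflexive (sym x≡y)) ⟨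
        coeff (value f x y) _                   ≡⟨ ≡0 ⟩
        0#                                      ∎)

    value-top-x : ∀ {x y e} → HasDegree x e → y ≋ [] → coeff (value f x y) (a ℕ.+ e ℕ.+ e) ≢ 0#
    value-top-x {x} {y} {e} (x≤e , xe≢0) y≋[] ≡0 = square-term≢0 (proj₂ A-degree) xe≢0 (begin
      coeff A a * coeff x e * coeff x e   ≡⟨ proj₂ (*ₚ-leading³ A x x (proj₁ A-degree) x≤e x≤e) ⟨
      coeff (A *ₚ x *ₚ x) N               ≡⟨ trans (+-identityʳ _) (+-identityʳ _) ⟨
      coeff (A *ₚ x *ₚ x) N + 0# + 0#     ≡⟨ cong₂ (λ u v → coeff (A *ₚ x *ₚ x) N + u + v)
                                               (coeff-≡ (*ₚ-≋[] (B *ₚ x) y≋[]) N) (coeff-≡ (*ₚ-≋[] (C *ₚ y) y≋[]) N) ⟨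
      coeff (A *ₚ x *ₚ x) N + coeff (B *ₚ x *ₚ y) N + coeff (C *ₚ y *ₚ y) N ≡⟨ coeff-value A B C x y N ⟨
      coeff (value f x y) N               ≡⟨ ≡0 ⟩
      0#                                  ∎)
      where N = a ℕ.+ e ℕ.+ e

    value-top-y : ∀ {x y g} → x ≋ [] → HasDegree y g → coeff (value f x y) (c ℕ.+ g ℕ.+ g) ≢ 0#
    value-top-y {x} {y} {g} x≋[] (y≤g , yg≢0) ≡0 = square-term≢0 (proj₂ C-degree) yg≢0 (begin
      coeff C c * coeff y g * coeff y g   ≡⟨ proj₂ (*ₚ-leading³ C y y (proj₁ C-degree) y≤g y≤g) ⟨
      coeff (C *ₚ y *ₚ y) N               ≡⟨ trans (cong (_+ coeff (C *ₚ y *ₚ y) N) (+-identityʳ 0#)) (+-identityˡ _) ⟨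
      0# + 0# + coeff (C *ₚ y *ₚ y) N     ≡⟨ cong₂ (λ u v → u + v + coeff (C *ₚ y *ₚ y) N)
                                               (coeff-≡ (*ₚ-zeroˡ (*ₚ-≋[] A x≋[]) x) N) (coeff-≡ (*ₚ-zeroˡ (*ₚ-≋[] B x≋[]) y) N) ⟨
      coeff (A *ₚ x *ₚ x) N + coeff (B *ₚ x *ₚ y) N + coeff (C *ₚ y *ₚ y) N ≡⟨ coeff-value A B C x y N ⟨
      coeff (value f x y) N               ≡⟨ ≡0 ⟩
      0#                                  ∎)
      where N = c ℕ.+ g ℕ.+ g

    value-bound-x : ∀ {x y e N} → HasDegree x e → value f x y ≤ᵈ N → a ℕ.+ e ℕ.+ e ≤ N
    value-bound-x {x} {y} x-degree v≤N with zero⊎degree y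
    ... | inj₁ y≋[]           = coeff≢0⇒≤ {value f x y} v≤N (value-top-x {x} {y} x-degree y≋[])
    ... | inj₂ (_ , y-degree) with value-top {x} {y} x-degree y-degree
    ...   | _ , x≤M , _ , vM≢0 = ℕ.≤-trans x≤M (coeff≢0⇒≤ {value f x y} v≤N vM≢0)

    value-bound-y : ∀ {x y g N} → HasDegree y g → value f x y ≤ᵈ N → c ℕ.+ g ℕ.+ g ≤ N
    value-bound-y {x} {y} y-degree v≤N with zero⊎degree x
    ... | inj₁ x≋[]           = coeff≢0⇒≤ {value f x y} v≤N (value-top-y {x} {y} x≋[] y-degree)
    ... | inj₂ (_ , x-degree) with value-top {x} {y} x-degree y-degree
    ...   | _ , _ , y≤M , vM≢0 = ℕ.≤-trans y≤M (coeff≢0⇒≤ {value f x y} v≤N vM≢0)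

  4≡2*2 : 4# ≡ 2# * 2#
  4≡2*2 = trans (cong (λ z → 1# + (1# + (1# + z))) (+-identityʳ 1#))
                (solve 0 (con (ℤ.+ 4) := con (ℤ.+ 2) :* con (ℤ.+ 2)) refl)

  module ReducedForm (A B C : Poly) {a c : ℕ}
    (A-degree : HasDegree A a) (C-degree : HasDegree C c) (a≤c : a ≤ c)
    (B-small : ∀ i → a ≤ i → coeff B i ≡ 0#) (2≢0 : 2# ≢ 0#)
    where

    D : Poly
    D = disc (form A B C)

    coeff-disc : ∀ i → coeff D i ≡ coeff (B *ₚ B) i + - (4# * coeff (A *ₚ C) i)
    coeff-disc i = trans (coeff--ₚ (B *ₚ B) (const 4# *ₚ (A *ₚ C)) i)
                         (cong (λ z → coeff (B *ₚ B) i + - z) (coeff-const*ₚ 4# (A *ₚ C) i))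

    B²-vanishes : ∀ i → a ℕ.+ c ≤ i → coeff (B *ₚ B) i ≡ 0#
    B²-vanishes i a+c≤i = ≤ᵈ-vanishes {B *ₚ B} (proj₁ lead)
      (trans (proj₂ lead) (trans (cong (_* coeff B a) (B-small a ℕ.≤-refl)) (zeroˡ _)))
      i (ℕ.≤-trans (ℕ.+-monoʳ-≤ a a≤c) a+c≤i)
      where
      B≤a : B ≤ᵈ a
      B≤a i a<i = B-small i (ℕ.<⇒≤ a<i)
      lead : B *ₚ B ≤ᵈ a ℕ.+ a × coeff (B *ₚ B) (a ℕ.+ a) ≡ coeff B a * coeff B a
      lead = *ₚ-leading B B B≤a B≤a

    disc-leading : coeff D (a ℕ.+ c) ≡ - (4# * (coeff A a * coeff C c))
    disc-leading = begin
      coeff D (a ℕ.+ c)                                          ≡⟨ coeff-disc _ ⟩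
      coeff (B *ₚ B) (a ℕ.+ c) + - (4# * coeff (A *ₚ C) (a ℕ.+ c)) ≡⟨ cong₂ (λ u v → u + - (4# * v))
                                                                      (B²-vanishes _ ℕ.≤-refl)
                                                                      (proj₂ (*ₚ-leading A C (proj₁ A-degree) (proj₁ C-degree))) ⟩
      0# + - (4# * (coeff A a * coeff C c))                      ≡⟨ +-identityˡ _ ⟩
      - (4# * (coeff A a * coeff C c))                           ∎

    disc-degree : HasDegree D (a ℕ.+ c)
    disc-degree = bound , λ ≡0 → -‿≢0 4AC≢0 (trans (sym disc-leading) ≡0)
      where
      4AC≢0 : 4# * (coeff A a * coeff C c) ≢ 0#
      4AC≢0 = *-≢0 (λ 4≡0 → *-≢0 2≢0 2≢0 (trans (sym 4≡2*2) 4≡0)) (*-≢0 (proj₂ A-degree) (proj₂ C-degree))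
      bound : D ≤ᵈ a ℕ.+ c
      bound i a+c<i = begin
        coeff D i                                       ≡⟨ coeff-disc i ⟩
        coeff (B *ₚ B) i + - (4# * coeff (A *ₚ C) i)    ≡⟨ cong₂ (λ u v → u + - (4# * v)) (B²-vanishes i (ℕ.<⇒≤ a+c<i))
                                                             (proj₁ (*ₚ-leading A C (proj₁ A-degree) (proj₁ C-degree)) i a+c<i) ⟩
        0# + - (4# * 0#)                                ≡⟨ trans (+-identityˡ _) (trans (cong -_ (zeroʳ 4#)) -0#≈0#) ⟩
        0#                                              ∎

    deg-disc : deg D ≡ a ℕ.+ c
    deg-disc = cong (ℕ._∸ 1) (proj₁ (degree⇒size,sgn {D} disc-degree))

    sgn-disc : sgn D ≡ - (4# * (coeff A a * coeff C c))
    sgn-disc = trans (proj₂ (degree⇒size,sgn {D} disc-degree)) disc-leading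

    equal-degrees⇒unusual : a ≡ c → Imaginary D ⊎ Unusual D → Unusual D
    equal-degrees⇒unusual a≡c (inj₂ unusual)  = unusual
    equal-degrees⇒unusual a≡c (inj₁ imaginary) = ⊥-elim (ℕ.0≢1+n (begin
      0                  ≡⟨ balanced⇒even a c 0 0 (cong (λ n → n ℕ.+ 0 ℕ.+ 0) a≡c) ⟨
      (a ℕ.+ c) % 2      ≡⟨ cong (_% 2) deg-disc ⟨
      deg D % 2          ≡⟨ imaginary ⟩
      1                  ∎))

    leading-C*λ≡1 : ∀ {h} → a ≡ c → coeff A a ≡ 1# → Imaginary D ⊎ Unusual D → Normalized h D → coeff C c * lam h ≡ 1#
    leading-C*λ≡1 {h} a≡c sA≡1 imaginary⊎unusual (inj₁ sgnD≡1) =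
      ⊥-elim (proj₂ (equal-degrees⇒unusual a≡c imaginary⊎unusual) (1# , trans (*-identityˡ 1#) (sym sgnD≡1)))
    leading-C*λ≡1 {h} a≡c sA≡1 _ (inj₂ sgnD≡h) = begin
      t * - (4# * h ⁻¹)               ≡⟨ solve 3 (λ t four h⁻¹ → t :* :- (four :* h⁻¹) := :- (four :* (con (ℤ.+ 1) :* t)) :* h⁻¹) refl t 4# (h ⁻¹) ⟩
      - (4# * (1# * t)) * h ⁻¹        ≡⟨ cong (λ z → - (4# * (z * t)) * h ⁻¹) sA≡1 ⟨
      - (4# * (coeff A a * t)) * h ⁻¹ ≡⟨ cong (_* h ⁻¹) (trans (sym sgn-disc) sgnD≡h) ⟩
      h * h ⁻¹                        ≡⟨ ⁻¹-inverse h h≢0 ⟩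
      1#                              ∎
      where
      t = coeff C c
      h≢0 : h ≢ 0#
      h≢0 h≡0 = proj₂ disc-degree (trans (sym (proj₂ (degree⇒size,sgn {D} disc-degree))) (trans sgnD≡h h≡0))

    equal-degrees⇒C-nonunit : a ≡ c → NonConstant D → ¬ IsUnit C
    equal-degrees⇒C-nonunit refl nonconstant C-unit with unit⇒degree0 {C} C-degree C-unit
    ... | refl = ℕ.<-irrefl refl (subst (2 ≤_) (proj₁ (degree⇒size,sgn {D} disc-degree)) nonconstant)

    -- A cancellation would make sgn D = -4 sA sC the square of 2 sC t / s, and for
    -- imaginary D it contradicts the parity of deg D = a + c.
    no-cancellation : Imaginary D ⊎ Unusual D →
                      ∀ {e g s t} → s ≢ 0# → t ≢ 0# → a ℕ.+ e ℕ.+ e ≡ c ℕ.+ g ℕ.+ g →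
                      coeff A a * s * s + coeff C c * t * t ≢ 0#
    no-cancellation (inj₁ imaginary) {e} {g} _ _ balanced _ =
      ℕ.0≢1+n (trans (sym (balanced⇒even a c e g balanced)) (trans (cong (_% 2) (sym deg-disc)) imaginary))
    no-cancellation (inj₂ (_ , non-square)) {s = s} {t} s≢0 _ _ cancels =
      non-square (2# * sC * t * w , trans (+-inverseˡ-unique _ _ sum≡0) (begin
        - (2# * 2# * (sA * sC))   ≡⟨ cong (λ z → - (z * (sA * sC))) 4≡2*2 ⟨
        - (4# * (sA * sC))        ≡⟨ sgn-disc ⟨
        sgn D                     ∎))
      where
      sA = coeff A a
      sC = coeff C c
      w = s ⁻¹
      sum≡0 : 2# * sC * t * w * (2# * sC * t * w) + 2# * 2# * (sA * sC) ≡ 0#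
      sum≡0 = begin
        2# * sC * t * w * (2# * sC * t * w) + 2# * 2# * (sA * sC)
          ≡⟨ solve 6 (λ sA sC s t w two → two :* sC :* t :* w :* (two :* sC :* t :* w) :+ two :* two :* (sA :* sC)
                  := two :* two :* sC :* w :* w :* (sA :* s :* s :+ sC :* t :* t)
                     :+ two :* two :* sA :* sC :* (con (ℤ.+ 1) :+ :- (s :* w :* (s :* w)))) refl sA sC s t w 2# ⟩
        2# * 2# * sC * w * w * (sA * s * s + sC * t * t) + 2# * 2# * sA * sC * (1# + - (s * w * (s * w)))
          ≡⟨ cong₂ (λ u v → 2# * 2# * sC * w * w * u + 2# * 2# * sA * sC * (1# + - v))
                   cancels (trans (cong₂ _*_ (⁻¹-inverse s s≢0) (⁻¹-inverse s s≢0)) (*-identityʳ 1#)) ⟩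
        2# * 2# * sC * w * w * 0# + 2# * 2# * sA * sC * (1# + - 1#)
          ≡⟨ cong₂ (λ u v → u + 2# * 2# * sA * sC * v) (zeroʳ _) (-‿inverseʳ 1#) ⟩
        0# + 2# * 2# * sA * sC * 0#
          ≡⟨ trans (+-identityˡ _) (zeroʳ _) ⟩
        0# ∎

  const*ₚconst : ∀ x y → const x *ₚ const y ≋ const (x * y)
  const*ₚconst x y = coeffwise λ { zero → coeff-const*ₚ x (const y) 0 ; (suc i) → trans (coeff-const*ₚ x (const y) (suc i)) (zeroʳ x) }

  const-+ₚ : ∀ x y → const x +ₚ const y ≋ const (x + y)
  const-+ₚ x y = coeffwise λ { zero → refl ; (suc i) → refl }

  *ₚ-const-cong : ∀ {p r x y} → p ≋ const x → r ≋ const y → p *ₚ r ≋ const (x * y)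
  *ₚ-const-cong p≋x r≋y = ≋-trans (*ₚ-cong p≋x r≋y) (const*ₚconst _ _)

  coeff-value-const : ∀ A B C {x y s t} → x ≋ const s → y ≋ const t → ∀ i →
                      coeff (value (form A B C) x y) i ≡ coeff A i * s * s + coeff B i * s * t + coeff C i * t * t
  coeff-value-const A B C {x} {y} x≋s y≋t i = trans (coeff-value A B C x y i)
    (cong₂ _+_ (cong₂ _+_ (term A x≋s x≋s) (term B x≋s y≋t)) (term C y≋t y≋t))
    where
    term : ∀ P {x y s t} → x ≋ const s → y ≋ const t → coeff (P *ₚ x *ₚ y) i ≡ coeff P i * s * t
    term P {x} x≋s y≋t = trans (coeff-*ₚ≋const (P *ₚ x) y≋t i) (cong (_* _) (coeff-*ₚ≋const P x≋s i))

  coeff-cross-const : ∀ A B C {α β γ δ a b c d} →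
                      α ≋ const a → β ≋ const b → γ ≋ const c → δ ≋ const d → ∀ i →
                      coeff (Form.B (form A B C ∘F mat α β γ δ)) i
                      ≡ 2# * coeff A i * a * b + coeff B i * (a * d + b * c) + 2# * coeff C i * c * d
  coeff-cross-const A B C {α} {β} {γ} {δ} {a} {b} {c} {d} α≋a β≋b γ≋c δ≋d i =
    trans (coeff-+ₚ (const 2# *ₚ A *ₚ α *ₚ β +ₚ B *ₚ (α *ₚ δ +ₚ β *ₚ γ)) _ i)
      (cong₂ _+_ (trans (coeff-+ₚ (const 2# *ₚ A *ₚ α *ₚ β) _ i)
                   (cong₂ _+_ (term A α≋a β≋b)
                              (coeff-*ₚ≋const B (≋-trans (+ₚ-cong (*ₚ-const-cong α≋a δ≋d) (*ₚ-const-cong β≋b γ≋c)) (const-+ₚ _ _)) i)))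
                 (term C γ≋c δ≋d))
    where
    term : ∀ P {x y s t} → x ≋ const s → y ≋ const t → coeff (const 2# *ₚ P *ₚ x *ₚ y) i ≡ 2# * coeff P i * s * t
    term P {x} x≋s y≋t = trans (coeff-*ₚ≋const (const 2# *ₚ P *ₚ x) y≋t i)
      (cong (_* _) (trans (coeff-*ₚ≋const (const 2# *ₚ P) x≋s i) (cong (_* _) (coeff-const*ₚ 2# P i))))

  det-const : ∀ {α β γ δ a b c d} → α ≋ const a → β ≋ const b → γ ≋ const c → δ ≋ const d →
              det (mat α β γ δ) ≋ const (a * d + - (b * c))
  det-const {α} {β} {γ} {δ} {a} {b} {c} {d} α≋a β≋b γ≋c δ≋d = coeffwise λ i →
    trans (coeff--ₚ (α *ₚ δ) (β *ₚ γ) i)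
      (trans (cong₂ (λ u v → u + - v) (coeff-≡ (*ₚ-const-cong α≋a δ≋d) i) (coeff-≡ (*ₚ-const-cong β≋b γ≋c) i))
             (sym (coeff--ₚ (const (a * d)) (const (b * c)) i)))

  module IsometryOfDiagonalForm {t λ' u a b c d : Carrier} (tλ≡1 : t * λ' ≡ 1#)
    (E₁ : a * a + t * c * c ≡ 1#) (E₂ : b * b + t * d * d ≡ t) (E₃ : a * b + t * c * d ≡ 0#)
    (det≡u : a * d + - (b * c) ≡ u)
    where

    t≢0 : t ≢ 0#
    t≢0 t≡0 = 1≢0 (trans (sym tλ≡1) (trans (cong (_* λ') t≡0) (zeroˡ λ')))

    u²≡1 : u * u ≡ 1#
    u²≡1 = *-cancelˡ t≢0 (begin
      t * (u * u)                                              ≡⟨ cong (λ z → t * (z * z)) det≡u ⟨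
      t * ((a * d + - (b * c)) * (a * d + - (b * c)))
        ≡⟨ solve 5 (λ t a b c d → t :* ((a :* d :+ :- (b :* c)) :* (a :* d :+ :- (b :* c)))
                 := (a :* a :+ t :* c :* c) :* (b :* b :+ t :* d :* d) :+ :- ((a :* b :+ t :* c :* d) :* (a :* b :+ t :* c :* d)))
                 refl t a b c d ⟩
      (a * a + t * c * c) * (b * b + t * d * d) + - ((a * b + t * c * d) * (a * b + t * c * d))
        ≡⟨ cong₃ (λ x y z → x * y + - (z * z)) E₁ E₂ E₃ ⟩
      1# * t + - (0# * 0#)                                     ≡⟨ solve 1 (λ t → con (ℤ.+ 1) :* t :+ :- (con (ℤ.+ 0) :* con (ℤ.+ 0)) := t :* con (ℤ.+ 1)) refl t ⟩
      t * 1#                                                   ∎)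

    b≡-tcu : b ≡ - (t * c * u)
    b≡-tcu = +-inverseʳ-unique _ _ (begin
      t * c * u + b                                           ≡⟨ cong (t * c * u +_) (*-identityʳ b) ⟨
      t * c * u + b * 1#                                      ≡⟨ cong₂ (λ x y → t * c * x + b * y) det≡u E₁ ⟨
      t * c * (a * d + - (b * c)) + b * (a * a + t * c * c)
        ≡⟨ solve 5 (λ t a b c d → t :* c :* (a :* d :+ :- (b :* c)) :+ b :* (a :* a :+ t :* c :* c)
                 := a :* (a :* b :+ t :* c :* d)) refl t a b c d ⟩
      a * (a * b + t * c * d)                                 ≡⟨ trans (cong (a *_) E₃) (zeroʳ a) ⟩
      0#                                                      ∎)

    a≡du : a ≡ d * u
    a≡du = x∙y⁻¹≈ε⇒x≈y a (d * u) (x*y≡0⇒y≡0 t≢0 (begin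
      t * (a + - (d * u))                                     ≡⟨ solve 4 (λ t a d u → t :* (a :+ :- (d :* u)) := a :* t :+ :- (t :* d :* u)) refl t a d u ⟩
      a * t + - (t * d * u)                                   ≡⟨ cong₂ (λ x y → a * x + - (t * d * y)) E₂ det≡u ⟨
      a * (b * b + t * d * d) + - (t * d * (a * d + - (b * c)))
        ≡⟨ solve 5 (λ t a b c d → a :* (b :* b :+ t :* d :* d) :+ :- (t :* d :* (a :* d :+ :- (b :* c)))
                 := b :* (a :* b :+ t :* c :* d)) refl t a b c d ⟩
      b * (a * b + t * c * d)                                 ≡⟨ trans (cong (b *_) E₃) (zeroʳ b) ⟩
      0#                                                      ∎))

    d≡ua : d ≡ u * a
    d≡ua = sym (begin
      u * a             ≡⟨ cong (u *_) a≡du ⟩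
      u * (d * u)       ≡⟨ solve 2 (λ u d → u :* (d :* u) := d :* (u :* u)) refl u d ⟩
      d * (u * u)       ≡⟨ trans (cong (d *_) u²≡1) (*-identityʳ d) ⟩
      d                 ∎)

    c≡-uλb : c ≡ - (u * λ' * b)
    c≡-uλb = sym (begin
      - (u * λ' * b)                ≡⟨ cong (λ z → - (u * λ' * z)) b≡-tcu ⟩
      - (u * λ' * - (t * c * u))    ≡⟨ solve 4 (λ t λ' u c → :- (u :* λ' :* :- (t :* c :* u)) := (t :* λ') :* (u :* u) :* c) refl t λ' u c ⟩
      (t * λ') * (u * u) * c        ≡⟨ cong₂ (λ x y → x * y * c) tλ≡1 u²≡1 ⟩
      1# * 1# * c                   ≡⟨ trans (cong (_* c) (*-identityˡ 1#)) (*-identityˡ c) ⟩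
      c                             ∎)

    a²+λb²≡1 : a * a + λ' * b * b ≡ 1#
    a²+λb²≡1 = trans (cong (a * a +_) λb²≡tc²) E₁
      where
      λb²≡tc² : λ' * b * b ≡ t * c * c
      λb²≡tc² = begin
        λ' * b * b                                  ≡⟨ cong (λ z → λ' * z * z) b≡-tcu ⟩
        λ' * - (t * c * u) * - (t * c * u)          ≡⟨ solve 4 (λ t λ' u c → λ' :* :- (t :* c :* u) :* :- (t :* c :* u)
                                                           := (t :* λ') :* (u :* u) :* (t :* c :* c)) refl t λ' u c ⟩
        (t * λ') * (u * u) * (t * c * c)            ≡⟨ cong₂ (λ x y → x * y * (t * c * c)) tλ≡1 u²≡1 ⟩
        1# * 1# * (t * c * c)                       ≡⟨ trans (cong (_* (t * c * c)) (*-identityˡ 1#)) (*-identityˡ _) ⟩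
        t * c * c                                   ∎

  module IsometryCoefficients {λ' u a b : Carrier} (u²≡1 : u * u ≡ 1#) (a²+λb²≡1 : a * a + λ' * b * b ≡ 1#) where

    c d : Carrier
    c = - (u * λ' * b)
    d = u * a

    u≢0 : u ≢ 0#
    u≢0 u≡0 = 1≢0 (trans (sym u²≡1) (trans (cong (_* u) u≡0) (zeroˡ u)))

    first-column : λ' ≢ 0# → b ≢ 0# → ∀ {X Y Z} →
                   X ≡ X * a * a + Y * a * c + Z * c * c → a * Y ≡ u * b * (λ' * Z + - X)
    first-column λ≢0 b≢0 {X} {Y} {Z} X≡ = x∙y⁻¹≈ε⇒x≈y _ _ (x*y≡0⇒y≡0 (-‿≢0 (*-≢0 (*-≢0 λ≢0 b≢0) u≢0)) (begin
      - (λ' * b * u) * (a * Y + - (u * b * (λ' * Z + - X)))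
        ≡⟨ +-identityʳ _ ⟨
      - (λ' * b * u) * (a * Y + - (u * b * (λ' * Z + - X))) + 0#
        ≡⟨ cong (_ +_) (trans (cong (X *_) (x≈y⇒x∙y⁻¹≈ε P)) (zeroʳ X)) ⟨
      - (λ' * b * u) * (a * Y + - (u * b * (λ' * Z + - X))) + X * (a * a + λ' * b * b * (u * u) + - 1#)
        ≡⟨ solve 7 (λ X Y Z a b u λ' →
             :- (λ' :* b :* u) :* (a :* Y :+ :- (u :* b :* (λ' :* Z :+ :- X)))
               :+ X :* (a :* a :+ λ' :* b :* b :* (u :* u) :+ :- con (ℤ.+ 1))
             := X :* a :* a :+ Y :* a :* :- (u :* λ' :* b) :+ Z :* :- (u :* λ' :* b) :* :- (u :* λ' :* b) :+ :- X)
             refl X Y Z a b u λ' ⟩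
      X * a * a + Y * a * c + Z * c * c + - X
        ≡⟨ x≈y⇒x∙y⁻¹≈ε (sym X≡) ⟩
      0# ∎))
      where
      P : a * a + λ' * b * b * (u * u) ≡ 1#
      P = trans (cong (λ z → a * a + λ' * b * b * z) u²≡1) (trans (cong (a * a +_) (*-identityʳ _)) a²+λb²≡1)

    cross-term : ∀ {X Y Z} → a * Y ≡ u * b * (λ' * Z + - X) →
                 Y ≡ 2# * X * a * b + Y * (a * d + b * c) + 2# * Z * c * d → (1# + u) * Y ≡ 0#
    cross-term {X} {Y} {Z} first Y≡ = begin
      (1# + u) * Y
        ≡⟨ solve 2 (λ Y u → (con (ℤ.+ 1) :+ u) :* Y := Y :+ u :* Y) refl Y u ⟩
      Y + u * Y
        ≡⟨ cong (_+ u * Y) Y≡ ⟩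
      2# * X * a * b + Y * (a * d + b * c) + 2# * Z * c * d + u * Y
        ≡⟨ solve 7 (λ X Y Z a b u λ' →
             con (ℤ.+ 2) :* X :* a :* b :+ Y :* (a :* (u :* a) :+ b :* :- (u :* λ' :* b))
               :+ con (ℤ.+ 2) :* Z :* :- (u :* λ' :* b) :* (u :* a) :+ u :* Y
             := con (ℤ.+ 2) :* a :* u :* (a :* Y :+ :- (u :* b :* (λ' :* Z :+ :- X)))
               :+ con (ℤ.+ 2) :* a :* b :* X :* (con (ℤ.+ 1) :+ :- (u :* u))
               :+ u :* Y :* (con (ℤ.+ 1) :+ :- (a :* a :+ λ' :* b :* b)))
             refl X Y Z a b u λ' ⟩
      2# * a * u * (a * Y + - (u * b * (λ' * Z + - X))) + 2# * a * b * X * (1# + - (u * u))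
        + u * Y * (1# + - (a * a + λ' * b * b))
        ≡⟨ cong₃ (λ x y z → 2# * a * u * x + 2# * a * b * X * y + u * Y * z)
                 (x≈y⇒x∙y⁻¹≈ε first) (x≈y⇒x∙y⁻¹≈ε (sym u²≡1)) (x≈y⇒x∙y⁻¹≈ε (sym a²+λb²≡1)) ⟩
      2# * a * u * 0# + 2# * a * b * X * 0# + u * Y * 0#
        ≡⟨ solve 5 (λ X Y a b u → con (ℤ.+ 2) :* a :* u :* con (ℤ.+ 0) :+ con (ℤ.+ 2) :* a :* b :* X :* con (ℤ.+ 0)
                                 :+ u :* Y :* con (ℤ.+ 0) := con (ℤ.+ 0)) refl X Y a b u ⟩
      0# ∎

  module NonTrivialIsometry {λ' k b : Carrier} (b²[k²+λ]≡1 : b * b * (k * k + λ') ≡ 1#) where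

    α₀ γ₀ δ₀ : Carrier
    α₀ = - (b * k)
    γ₀ = λ' * b
    δ₀ = b * k

    det≡-1 : α₀ * δ₀ + - (b * γ₀) ≡ - 1#
    det≡-1 = trans (solve 3 (λ b k λ' → :- (b :* k) :* (b :* k) :+ :- (b :* (λ' :* b)) := :- (b :* b :* (k :* k :+ λ'))) refl b k λ')
                   (cong -_ b²[k²+λ]≡1)

    module _ {X Y Z : Carrier} (λZ-X≡kY : λ' * Z + - X ≡ k * Y) where

      private
        E : λ' * Z + - X + - (k * Y) ≡ 0#
        E = x≈y⇒x∙y⁻¹≈ε λZ-X≡kY

      preserves-A : X ≡ X * α₀ * α₀ + Y * α₀ * γ₀ + Z * γ₀ * γ₀
      preserves-A = sym (begin
        X * α₀ * α₀ + Y * α₀ * γ₀ + Z * γ₀ * γ₀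
          ≡⟨ solve 6 (λ X Y Z b k λ' → X :* :- (b :* k) :* :- (b :* k) :+ Y :* :- (b :* k) :* (λ' :* b) :+ Z :* (λ' :* b) :* (λ' :* b)
                   := b :* b :* (k :* k :+ λ') :* X :+ b :* b :* λ' :* (λ' :* Z :+ :- X :+ :- (k :* Y))) refl X Y Z b k λ' ⟩
        b * b * (k * k + λ') * X + b * b * λ' * (λ' * Z + - X + - (k * Y))
          ≡⟨ cong₂ (λ x y → x * X + b * b * λ' * y) b²[k²+λ]≡1 E ⟩
        1# * X + b * b * λ' * 0#
          ≡⟨ trans (cong₂ _+_ (*-identityˡ X) (zeroʳ _)) (+-identityʳ X) ⟩
        X ∎)

      preserves-B : Y ≡ 2# * X * α₀ * b + Y * (α₀ * δ₀ + b * γ₀) + 2# * Z * γ₀ * δ₀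
      preserves-B = sym (begin
        2# * X * α₀ * b + Y * (α₀ * δ₀ + b * γ₀) + 2# * Z * γ₀ * δ₀
          ≡⟨ solve 6 (λ X Y Z b k λ' → con (ℤ.+ 2) :* X :* :- (b :* k) :* b :+ Y :* (:- (b :* k) :* (b :* k) :+ b :* (λ' :* b))
                                        :+ con (ℤ.+ 2) :* Z :* (λ' :* b) :* (b :* k)
                   := b :* b :* (k :* k :+ λ') :* Y :+ con (ℤ.+ 2) :* b :* b :* k :* (λ' :* Z :+ :- X :+ :- (k :* Y))) refl X Y Z b k λ' ⟩
        b * b * (k * k + λ') * Y + 2# * b * b * k * (λ' * Z + - X + - (k * Y))
          ≡⟨ cong₂ (λ x y → x * Y + 2# * b * b * k * y) b²[k²+λ]≡1 E ⟩
        1# * Y + 2# * b * b * k * 0#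
          ≡⟨ trans (cong₂ _+_ (*-identityˡ Y) (zeroʳ _)) (+-identityʳ Y) ⟩
        Y ∎)

      preserves-C : Z ≡ X * b * b + Y * b * δ₀ + Z * δ₀ * δ₀
      preserves-C = sym (begin
        X * b * b + Y * b * δ₀ + Z * δ₀ * δ₀
          ≡⟨ solve 6 (λ X Y Z b k λ' → X :* b :* b :+ Y :* b :* (b :* k) :+ Z :* (b :* k) :* (b :* k)
                   := b :* b :* (k :* k :+ λ') :* Z :+ :- (b :* b :* (λ' :* Z :+ :- X :+ :- (k :* Y)))) refl X Y Z b k λ' ⟩
        b * b * (k * k + λ') * Z + - (b * b * (λ' * Z + - X + - (k * Y)))
          ≡⟨ cong₂ (λ x y → x * Z + - (b * b * y)) b²[k²+λ]≡1 E ⟩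
        1# * Z + - (b * b * 0#)
          ≡⟨ trans (cong₂ _+_ (*-identityˡ Z) (trans (cong -_ (zeroʳ _)) -0#≈0#)) (+-identityʳ Z) ⟩
        Z ∎)

  ≋const⇒≈ₚ : ∀ {p x y} → p ≋ const x → x ≡ y → p ≈ₚ const y
  ≋const⇒≈ₚ p≋x refl = ≋⇒≈ₚ p≋x

  const≉0 : ∀ {x} → x ≢ 0# → ¬ const x ≈ₚ 0ₚ
  const≉0 {x} x≢0 x≈0 = x≢0 (coeff-≡ (≈ₚ⇒≋ {const x} {[]} x≈0) 0)

  nonzero-coefficient : ∀ p → ¬ p ≈ₚ 0ₚ → ∃[ i ] coeff p i ≢ 0#
  nonzero-coefficient p p≉0 with zero⊎degree p
  ... | inj₁ p≋[]            = ⊥-elim (p≉0 (≋⇒≈ₚ p≋[]))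
  ... | inj₂ (d , _ , pd≢0)  = d , pd≢0

  ≋[]⇒≋const0 : ∀ {p} → p ≋ [] → p ≋ const 0#
  ≋[]⇒≋const0 p≋[] = coeffwise λ { zero → coeff-≡ p≋[] 0 ; (suc i) → coeff-≡ p≋[] (suc i) }

  module Automorphisms (A B C : Poly) {a c : ℕ}
    (A-degree : HasDegree A a) (C-degree : HasDegree C c) (a≤c : a ≤ c)
    (B-small : ∀ i → a ≤ i → coeff B i ≡ 0#) (2≢0 : 2# ≢ 0#)
    (imaginary⊎unusual : Imaginary (disc (form A B C)) ⊎ Unusual (disc (form A B C)))
    where

    f : Form
    f = form A B C

    open ReducedForm A B C A-degree C-degree a≤c B-small 2≢0 using (no-cancellation)
    open ValueDegree A B C A-degree C-degree a≤c B-small (no-cancellation imaginary⊎unusual)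

    StandardForm : Carrier → Mat → Set
    StandardForm λ' M =
      Σ Carrier λ α₀ → Σ Carrier λ β₀ → Σ Carrier λ u →
        (u ≡ 1# ⊎ u ≡ - 1#) × (det M ≈ₚ const u)
      × (M ≈M mat (const α₀) (const β₀) (const (- (u * λ' * β₀))) (const (u * α₀)))
      × (β₀ ≢ 0# → (¬ B ≈ₚ 0ₚ) × (const α₀ *ₚ B ≈ₚ const (u * β₀) *ₚ (scale λ' C -ₚ A)))

    module Entries {α β γ δ : Poly} (aut : IsAut f (mat α β γ δ)) where

      u : Carrier
      u = proj₁ (proj₁ aut)

      u≢0 : u ≢ 0#
      u≢0 = proj₁ (proj₂ (proj₁ aut))

      det≋u : det (mat α β γ δ) ≋ const u
      det≋u = ≈ₚ⇒≋ (proj₂ (proj₂ (proj₁ aut)))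

      A≋ : A ≋ value f α γ
      A≋ = ≈ₚ⇒≋ (proj₁ (proj₂ aut))

      B≋ : B ≋ Form.B (f ∘F mat α β γ δ)
      B≋ = ≈ₚ⇒≋ (proj₁ (proj₂ (proj₂ aut)))

      C≋ : C ≋ value f β δ
      C≋ = ≈ₚ⇒≋ (proj₂ (proj₂ (proj₂ aut)))

      value-αγ≤ᵈa : value f α γ ≤ᵈ a
      value-αγ≤ᵈa = ≋-≤ᵈ (≋-sym A≋) (proj₁ A-degree)

      value-βδ≤ᵈc : value f β δ ≤ᵈ c
      value-βδ≤ᵈc = ≋-≤ᵈ (≋-sym C≋) (proj₁ C-degree)

      module UnequalSizes (a<c : a < c) where

        γ≋[] : γ ≋ []
        γ≋[] with zero⊎degree γ
        ... | inj₁ γ≋[]           = γ≋[]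
        ... | inj₂ (g , γ-degree) = ⊥-elim (ℕ.<-irrefl refl (ℕ.<-≤-trans a<c (ℕ.≤-trans c≤c+g+g c+g+g≤a)))
          where
          c≤c+g+g : c ≤ c ℕ.+ g ℕ.+ g
          c≤c+g+g = ℕ.≤-trans (ℕ.m≤m+n c g) (ℕ.m≤m+n (c ℕ.+ g) g)
          c+g+g≤a : c ℕ.+ g ℕ.+ g ≤ a
          c+g+g≤a = value-bound-y {α} {γ} γ-degree value-αγ≤ᵈa

        αδ≋u : α *ₚ δ ≋ const u
        αδ≋u = coeffwise λ i → begin
          coeff (α *ₚ δ) i                              ≡⟨ +-identityʳ _ ⟨
          coeff (α *ₚ δ) i + 0#                         ≡⟨ cong (λ z → coeff (α *ₚ δ) i + z)
                                                             (trans (cong -_ (coeff-≡ (*ₚ-≋[] β γ≋[]) i)) -0#≈0#) ⟨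
          coeff (α *ₚ δ) i + - coeff (β *ₚ γ) i         ≡⟨ coeff--ₚ (α *ₚ δ) (β *ₚ γ) i ⟨
          coeff (det (mat α β γ δ)) i                   ≡⟨ coeff-≡ det≋u i ⟩
          coeff (const u) i                             ∎

        a₀ d₀ : Carrier
        a₀ = coeff α 0
        d₀ = coeff δ 0

        α≋a₀ : α ≋ const a₀
        α≋a₀ = proj₁ (*ₚ≋const⇒const α δ αδ≋u u≢0)

        δ≋d₀ : δ ≋ const d₀
        δ≋d₀ = proj₁ (proj₂ (*ₚ≋const⇒const α δ αδ≋u u≢0))

        a₀d₀≡u : a₀ * d₀ ≡ u
        a₀d₀≡u = proj₂ (proj₂ (*ₚ≋const⇒const α δ αδ≋u u≢0))

        γ≋0 : γ ≋ const 0#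
        γ≋0 = ≋[]⇒≋const0 γ≋[]

        diagonal-square≡1 : ∀ {X Y Z s} → X ≢ 0# → X ≡ X * s * s + Y * s * 0# + Z * 0# * 0# → s * s ≡ 1#
        diagonal-square≡1 {X} {Y} {Z} {s} X≢0 X≡ = *-cancelˡ X≢0 (begin
          X * (s * s)                                   ≡⟨ solve 4 (λ X Y Z s → X :* (s :* s) := X :* s :* s :+ Y :* s :* con (ℤ.+ 0) :+ Z :* con (ℤ.+ 0) :* con (ℤ.+ 0)) refl X Y Z s ⟩
          X * s * s + Y * s * 0# + Z * 0# * 0#          ≡⟨ X≡ ⟨
          X                                             ≡⟨ *-identityʳ X ⟨
          X * 1#                                        ∎)

        a₀²≡1 : a₀ * a₀ ≡ 1#
        a₀²≡1 = diagonal-square≡1 (proj₂ A-degree) (trans (coeff-≡ A≋ a) (coeff-value-const A B C α≋a₀ γ≋0 a))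

        a₀≢0 : a₀ ≢ 0#
        a₀≢0 a₀≡0 = 1≢0 (trans (sym a₀²≡1) (trans (cong (_* a₀) a₀≡0) (zeroˡ a₀)))

        β≋[] : β ≋ []
        β≋[] with zero⊎degree β
        ... | inj₁ β≋[]              = β≋[]
        ... | inj₂ (e , β≤e , βe≢0) = ⊥-elim (*-≢0 (*-≢0 (*-≢0 2≢0 (proj₂ A-degree)) a₀≢0) βe≢0 (begin
          2# * coeff A a * a₀ * coeff β e              ≡⟨ cong (_* coeff β e) (coeff-P a) ⟨
          coeff P a * coeff β e                        ≡⟨ proj₂ (*ₚ-leading P β P≤a β≤e) ⟨
          coeff (P *ₚ β) N                             ≡⟨ trans (+-identityʳ _) (+-identityʳ _) ⟨
          coeff (P *ₚ β) N + 0# + 0#                   ≡⟨ cong₂ (λ x y → coeff (P *ₚ β) N + x + y) middle-term last-term ⟨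
          coeff (P *ₚ β) N + coeff (B *ₚ (α *ₚ δ +ₚ β *ₚ γ)) N + coeff (const 2# *ₚ C *ₚ γ *ₚ δ) N
            ≡⟨ cong (_+ coeff (const 2# *ₚ C *ₚ γ *ₚ δ) N) (coeff-+ₚ (P *ₚ β) _ N) ⟨
          coeff (P *ₚ β +ₚ B *ₚ (α *ₚ δ +ₚ β *ₚ γ)) N + coeff (const 2# *ₚ C *ₚ γ *ₚ δ) N
            ≡⟨ coeff-+ₚ (P *ₚ β +ₚ B *ₚ (α *ₚ δ +ₚ β *ₚ γ)) _ N ⟨
          coeff (Form.B (f ∘F mat α β γ δ)) N          ≡⟨ coeff-≡ B≋ N ⟨
          coeff B N                                    ≡⟨ B-small N (ℕ.m≤m+n a e) ⟩
          0#                                           ∎))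
          where
          N = a ℕ.+ e
          P = const 2# *ₚ A *ₚ α
          coeff-P : ∀ j → coeff P j ≡ 2# * coeff A j * a₀
          coeff-P j = trans (coeff-*ₚ≋const (const 2# *ₚ A) α≋a₀ j) (cong (_* a₀) (coeff-const*ₚ 2# A j))
          P≤a : P ≤ᵈ a
          P≤a j a<j = trans (coeff-P j) (trans (cong (λ z → 2# * z * a₀) (proj₁ A-degree j a<j))
                                                (trans (cong (_* a₀) (zeroʳ 2#)) (zeroˡ a₀)))
          middle-term : coeff (B *ₚ (α *ₚ δ +ₚ β *ₚ γ)) N ≡ 0#
          middle-term = trans (coeff-*ₚ≋const B (+ₚ-cong αδ≋u (*ₚ-≋[] β γ≋[])) N)
                              (trans (cong (_* u) (B-small N (ℕ.m≤m+n a e))) (zeroˡ u))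
          last-term : coeff (const 2# *ₚ C *ₚ γ *ₚ δ) N ≡ 0#
          last-term = coeff-≡ (*ₚ-zeroˡ (*ₚ-≋[] (const 2# *ₚ C) γ≋[]) δ) N

        β≋0 : β ≋ const 0#
        β≋0 = ≋[]⇒≋const0 β≋[]

        d₀²≡1 : d₀ * d₀ ≡ 1#
        d₀²≡1 = *-cancelˡ (proj₂ C-degree) (begin
          coeff C c * (d₀ * d₀)                               ≡⟨ solve 4 (λ X Y Z d → Z :* (d :* d) := X :* con (ℤ.+ 0) :* con (ℤ.+ 0) :+ Y :* con (ℤ.+ 0) :* d :+ Z :* d :* d)
                                                                   refl (coeff A c) (coeff B c) (coeff C c) d₀ ⟩
          coeff A c * 0# * 0# + coeff B c * 0# * d₀ + coeff C c * d₀ * d₀ ≡⟨ coeff-value-const A B C β≋0 δ≋d₀ c ⟨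
          coeff (value f β δ) c                               ≡⟨ coeff-≡ C≋ c ⟨
          coeff C c                                           ≡⟨ *-identityʳ _ ⟨
          coeff C c * 1#                                      ∎)

        B≡B*a₀d₀ : ∀ i → coeff B i ≡ coeff B i * (a₀ * d₀)
        B≡B*a₀d₀ i = begin
          coeff B i                                           ≡⟨ coeff-≡ B≋ i ⟩
          coeff (Form.B (f ∘F mat α β γ δ)) i                 ≡⟨ coeff-cross-const A B C α≋a₀ β≋0 γ≋0 δ≋d₀ i ⟩
          2# * coeff A i * a₀ * 0# + coeff B i * (a₀ * d₀ + 0# * 0#) + 2# * coeff C i * 0# * d₀
            ≡⟨ solve 5 (λ X Y Z a d → con (ℤ.+ 2) :* X :* a :* con (ℤ.+ 0) :+ Y :* (a :* d :+ con (ℤ.+ 0) :* con (ℤ.+ 0))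
                                       :+ con (ℤ.+ 2) :* Z :* con (ℤ.+ 0) :* d := Y :* (a :* d))
                     refl (coeff A i) (coeff B i) (coeff C i) a₀ d₀ ⟩
          coeff B i * (a₀ * d₀)                               ∎

        a₀d₀≡-1⇒B≈0 : a₀ * d₀ ≡ - 1# → B ≈ₚ 0ₚ
        a₀d₀≡-1⇒B≈0 a₀d₀≡-1 = ≋⇒≈ₚ {B} {[]} (coeffwise λ i → x*y≡0⇒y≡0 2≢0 (begin
          2# * coeff B i                    ≡⟨ solve 1 (λ x → con (ℤ.+ 2) :* x := x :+ :- (x :* :- con (ℤ.+ 1))) refl (coeff B i) ⟩
          coeff B i + - (coeff B i * - 1#)  ≡⟨ cong (λ z → coeff B i + - (coeff B i * z)) a₀d₀≡-1 ⟨
          coeff B i + - (coeff B i * (a₀ * d₀)) ≡⟨ x≈y⇒x∙y⁻¹≈ε (B≡B*a₀d₀ i) ⟩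
          0#                                ∎))

        classification : (mat α β γ δ ≈M I) ⊎ (mat α β γ δ ≈M negM I)
                       ⊎ (B ≈ₚ 0ₚ × ((mat α β γ δ ≈M J) ⊎ (mat α β γ δ ≈M negM J)))
        classification with x*x≡1⇒x≡±1 a₀²≡1 | x*x≡1⇒x≡±1 d₀²≡1
        ... | inj₁ a₀≡1  | inj₁ d₀≡1  =
          inj₁ (≋const⇒≈ₚ α≋a₀ a₀≡1 , ≋⇒≈ₚ β≋[] , ≋⇒≈ₚ γ≋[] , ≋const⇒≈ₚ δ≋d₀ d₀≡1)
        ... | inj₂ a₀≡-1 | inj₂ d₀≡-1 =
          inj₂ (inj₁ (≋const⇒≈ₚ α≋a₀ a₀≡-1 , ≋⇒≈ₚ β≋[] , ≋⇒≈ₚ γ≋[] , ≋const⇒≈ₚ δ≋d₀ d₀≡-1))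
        ... | inj₁ a₀≡1  | inj₂ d₀≡-1 =
          inj₂ (inj₂ (a₀d₀≡-1⇒B≈0 (trans (cong₂ _*_ a₀≡1 d₀≡-1) (*-identityˡ _)) ,
                      inj₁ (≋const⇒≈ₚ α≋a₀ a₀≡1 , ≋⇒≈ₚ β≋[] , ≋⇒≈ₚ γ≋[] , ≋const⇒≈ₚ δ≋d₀ d₀≡-1)))
        ... | inj₂ a₀≡-1 | inj₁ d₀≡1  =
          inj₂ (inj₂ (a₀d₀≡-1⇒B≈0 (trans (cong₂ _*_ a₀≡-1 d₀≡1) (*-identityʳ _)) ,
                      inj₂ (≋const⇒≈ₚ α≋a₀ a₀≡-1 , ≋⇒≈ₚ β≋[] , ≋⇒≈ₚ γ≋[] , ≋const⇒≈ₚ δ≋d₀ (trans d₀≡1 (sym (-‿involutive 1#))))))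

      module EqualSizes (a≡c : a ≡ c) (sA≡1 : coeff A a ≡ 1#) {λ' : Carrier} (tλ≡1 : coeff C c * λ' ≡ 1#)
                       (gcd-unit : Primitive f) (C-nonunit : ¬ IsUnit C) where

        constant : ∀ {p} → (∀ {e} → HasDegree p e → e ≡ 0) → p ≋ const (coeff p 0)
        constant {p} degree≡0 with zero⊎degree p
        ... | inj₁ p≋[]              = ≤ᵈ0⇒const (λ i _ → coeff-≡ p≋[] i)
        ... | inj₂ (e , p-degree) with degree≡0 p-degree
        ...   | refl = ≤ᵈ0⇒const (proj₁ p-degree)

        a₀ b₀ c₀ d₀ t : Carrier
        a₀ = coeff α 0
        b₀ = coeff β 0
        c₀ = coeff γ 0
        d₀ = coeff δ 0
        t  = coeff C c

        α≋a₀ : α ≋ const a₀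
        α≋a₀ = constant λ {e} α-degree → n+e+e≤n⇒e≡0 a e (value-bound-x {α} {γ} α-degree value-αγ≤ᵈa)

        γ≋c₀ : γ ≋ const c₀
        γ≋c₀ = constant λ {g} γ-degree → n+e+e≤n⇒e≡0 c g
          (subst (c ℕ.+ g ℕ.+ g ≤_) a≡c (value-bound-y {α} {γ} γ-degree value-αγ≤ᵈa))

        β≋b₀ : β ≋ const b₀
        β≋b₀ = constant λ {e} β-degree → n+e+e≤n⇒e≡0 a e
          (subst (a ℕ.+ e ℕ.+ e ≤_) (sym a≡c) (value-bound-x {β} {δ} β-degree value-βδ≤ᵈc))

        δ≋d₀ : δ ≋ const d₀
        δ≋d₀ = constant λ {g} δ-degree → n+e+e≤n⇒e≡0 c g (value-bound-y {β} {δ} δ-degree value-βδ≤ᵈc)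

        A-relation : ∀ i → coeff A i ≡ coeff A i * a₀ * a₀ + coeff B i * a₀ * c₀ + coeff C i * c₀ * c₀
        A-relation i = trans (coeff-≡ A≋ i) (coeff-value-const A B C α≋a₀ γ≋c₀ i)

        B-relation : ∀ i → coeff B i ≡ 2# * coeff A i * a₀ * b₀ + coeff B i * (a₀ * d₀ + b₀ * c₀) + 2# * coeff C i * c₀ * d₀
        B-relation i = trans (coeff-≡ B≋ i) (coeff-cross-const A B C α≋a₀ β≋b₀ γ≋c₀ δ≋d₀ i)

        C-relation : ∀ i → coeff C i ≡ coeff A i * b₀ * b₀ + coeff B i * b₀ * d₀ + coeff C i * d₀ * d₀
        C-relation i = trans (coeff-≡ C≋ i) (coeff-value-const A B C β≋b₀ δ≋d₀ i)

        private
          B-leading≡0 : coeff B a ≡ 0#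
          B-leading≡0 = B-small a ℕ.≤-refl

          C-leading : coeff C a ≡ t
          C-leading = cong (coeff C) a≡c

          at-leading-index : ∀ {r s} (F : Carrier → Carrier → Carrier → Carrier) → r ≡ F (coeff A a) (coeff B a) (coeff C a) → s ≡ F 1# 0# t → r ≡ s
          at-leading-index F r≡ ≡s = trans r≡ (trans (cong₃ F sA≡1 B-leading≡0 C-leading) (sym ≡s))

        E₁ : a₀ * a₀ + t * c₀ * c₀ ≡ 1#
        E₁ = sym (at-leading-index (λ X Y Z → X * a₀ * a₀ + Y * a₀ * c₀ + Z * c₀ * c₀) (trans (sym sA≡1) (A-relation a))
               (solve 3 (λ a c t → a :* a :+ t :* c :* c := con (ℤ.+ 1) :* a :* a :+ con (ℤ.+ 0) :* a :* c :+ t :* c :* c) refl a₀ c₀ t))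

        E₂ : b₀ * b₀ + t * d₀ * d₀ ≡ t
        E₂ = sym (at-leading-index (λ X Y Z → X * b₀ * b₀ + Y * b₀ * d₀ + Z * d₀ * d₀) (trans (sym C-leading) (C-relation a))
               (solve 3 (λ b d t → b :* b :+ t :* d :* d := con (ℤ.+ 1) :* b :* b :+ con (ℤ.+ 0) :* b :* d :+ t :* d :* d) refl b₀ d₀ t))

        E₃ : a₀ * b₀ + t * c₀ * d₀ ≡ 0#
        E₃ = x*y≡0⇒y≡0 2≢0 (sym (at-leading-index (λ X Y Z → 2# * X * a₀ * b₀ + Y * (a₀ * d₀ + b₀ * c₀) + 2# * Z * c₀ * d₀)
               (trans (sym B-leading≡0) (B-relation a))
               (solve 5 (λ a b c d t → con (ℤ.+ 2) :* (a :* b :+ t :* c :* d)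
                           := con (ℤ.+ 2) :* con (ℤ.+ 1) :* a :* b :+ con (ℤ.+ 0) :* (a :* d :+ b :* c) :+ con (ℤ.+ 2) :* t :* c :* d)
                        refl a₀ b₀ c₀ d₀ t)))

        det≡u : a₀ * d₀ + - (b₀ * c₀) ≡ u
        det≡u = trans (sym (coeff-≡ (det-const α≋a₀ β≋b₀ γ≋c₀ δ≋d₀) 0)) (coeff-≡ det≋u 0)

        open IsometryOfDiagonalForm tλ≡1 E₁ E₂ E₃ det≡u public using (u²≡1; d≡ua; c≡-uλb; a²+λb²≡1)
        open IsometryCoefficients u²≡1 a²+λb²≡1 using (first-column; cross-term)

        λ≢0 : λ' ≢ 0#
        λ≢0 λ≡0 = 1≢0 (trans (sym tλ≡1) (trans (cong (t *_) λ≡0) (zeroʳ t)))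

        normal-form : mat α β γ δ ≈M mat (const a₀) (const b₀) (const (- (u * λ' * b₀))) (const (u * a₀))
        normal-form = ≋⇒≈ₚ α≋a₀ , ≋⇒≈ₚ β≋b₀ ,
                      ≋⇒≈ₚ (subst (λ z → γ ≋ const z) c≡-uλb γ≋c₀) , ≋⇒≈ₚ (subst (λ z → δ ≋ const z) d≡ua δ≋d₀)

        column-relation : b₀ ≢ 0# → ∀ i → a₀ * coeff B i ≡ u * b₀ * (λ' * coeff C i + - coeff A i)
        column-relation b₀≢0 i = first-column λ≢0 b₀≢0
          (subst (λ z → coeff A i ≡ coeff A i * a₀ * a₀ + coeff B i * a₀ * z + coeff C i * z * z) c≡-uλb (A-relation i))

        B≉0 : b₀ ≢ 0# → ¬ B ≈ₚ 0ₚ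
        B≉0 b₀≢0 B≈0 = C-nonunit (gcd-unit C (const λ' , ≋⇒≈ₚ A≋Cλ) ([] , ≋⇒≈ₚ B≋C0) (const 1# , ≋⇒≈ₚ C≋C1))
          where
          A≋Cλ : A ≋ C *ₚ const λ'
          A≋Cλ = coeffwise λ i → begin
            coeff A i              ≡⟨ x∙y⁻¹≈ε⇒x≈y _ _ (x*y≡0⇒y≡0 (*-≢0 u≢0 b₀≢0) (begin
              u * b₀ * (λ' * coeff C i + - coeff A i) ≡⟨ column-relation b₀≢0 i ⟨
              a₀ * coeff B i                          ≡⟨ trans (cong (a₀ *_) (coeff-≡ (≈ₚ⇒≋ {B} {[]} B≈0) i)) (zeroʳ a₀) ⟩
              0#                                      ∎)) ⟨
            λ' * coeff C i         ≡⟨ *-comm λ' _ ⟩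
            coeff C i * λ'         ≡⟨ coeff-*ₚconst C λ' i ⟨
            coeff (C *ₚ const λ') i ∎
          B≋C0 : B ≋ C *ₚ []
          B≋C0 = ≋-trans (≈ₚ⇒≋ {B} {[]} B≈0) (≋-sym (*ₚ-zeroʳ C))
          C≋C1 : C ≋ C *ₚ const 1#
          C≋C1 = coeffwise λ i → trans (sym (*-identityʳ _)) (sym (coeff-*ₚconst C 1# i))

        B-relation′ : ∀ i → coeff B i ≡ 2# * coeff A i * a₀ * b₀ + coeff B i * (a₀ * (u * a₀) + b₀ * - (u * λ' * b₀))
                                       + 2# * coeff C i * - (u * λ' * b₀) * (u * a₀)
        B-relation′ i = subst₂ (λ z w → coeff B i ≡ 2# * coeff A i * a₀ * b₀ + coeff B i * (a₀ * w + b₀ * z) + 2# * coeff C i * z * w)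
                               c≡-uλb d≡ua (B-relation i)

        u≡-1 : b₀ ≢ 0# → u ≡ - 1#
        u≡-1 b₀≢0 = at (nonzero-coefficient B (B≉0 b₀≢0))
          where
          at : ∃[ i ] coeff B i ≢ 0# → u ≡ - 1#
          at (i , Bi≢0) = +-inverseʳ-unique 1# u (x*y≡0⇒y≡0 Bi≢0 (trans (*-comm (coeff B i) (1# + u))
                            (cross-term {coeff A i} {coeff B i} {coeff C i} (column-relation b₀≢0 i) (B-relation′ i))))

        polynomial-relation : b₀ ≢ 0# → const a₀ *ₚ B ≈ₚ const (u * b₀) *ₚ (scale λ' C -ₚ A)
        polynomial-relation b₀≢0 = ≋⇒≈ₚ {const a₀ *ₚ B} {const (u * b₀) *ₚ (scale λ' C -ₚ A)} (coeffwise λ i → begin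
          coeff (const a₀ *ₚ B) i                            ≡⟨ coeff-const*ₚ a₀ B i ⟩
          a₀ * coeff B i                                     ≡⟨ column-relation b₀≢0 i ⟩
          u * b₀ * (λ' * coeff C i + - coeff A i)            ≡⟨ cong (λ z → u * b₀ * (z + - coeff A i)) (coeff-scale λ' C i) ⟨
          u * b₀ * (coeff (scale λ' C) i + - coeff A i)      ≡⟨ cong (u * b₀ *_) (coeff--ₚ (scale λ' C) A i) ⟨
          u * b₀ * coeff (scale λ' C -ₚ A) i                 ≡⟨ coeff-const*ₚ (u * b₀) (scale λ' C -ₚ A) i ⟨
          coeff (const (u * b₀) *ₚ (scale λ' C -ₚ A)) i      ∎)

        b₀≢0 : ¬ β ≈ₚ 0ₚ → b₀ ≢ 0#
        b₀≢0 β≉0 b₀≡0 = β≉0 (≋⇒≈ₚ {β} {[]} (≋-trans β≋b₀ (coeffwise λ { zero → b₀≡0 ; (suc i) → refl })))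

        standard-form : StandardForm λ' (mat α β γ δ)
        standard-form = a₀ , b₀ , u , x*x≡1⇒x≡±1 u²≡1 , proj₂ (proj₂ (proj₁ aut)) , normal-form ,
                      λ b₀≢0 → B≉0 b₀≢0 , polynomial-relation b₀≢0

    module NonTrivial (a≡c : a ≡ c) (sA≡1 : coeff A a ≡ 1#) {λ' : Carrier} (tλ≡1 : coeff C c * λ' ≡ 1#)
                      (gcd-unit : Primitive f) (C-nonunit : ¬ IsUnit C) where

      Condition : Set
      Condition = (¬ B ≈ₚ 0ₚ)
                × Σ Carrier λ k → (scale λ' C -ₚ A ≈ₚ const k *ₚ B)
                × Σ Carrier λ y → (¬ y ≡ 0#) × (y * y ≡ k * k + λ')

      standard-form : ∀ M → IsAut f M → StandardForm λ' M
      standard-form M aut = Entries.EqualSizes.standard-form aut a≡c sA≡1 tλ≡1 gcd-unit C-nonunit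

      relation⇒coefficients : ∀ {k} → scale λ' C -ₚ A ≈ₚ const k *ₚ B → ∀ i → λ' * coeff C i + - coeff A i ≡ k * coeff B i
      relation⇒coefficients {k} rel i = begin
        λ' * coeff C i + - coeff A i            ≡⟨ cong (_+ - coeff A i) (coeff-scale λ' C i) ⟨
        coeff (scale λ' C) i + - coeff A i      ≡⟨ coeff--ₚ (scale λ' C) A i ⟨
        coeff (scale λ' C -ₚ A) i               ≡⟨ coeff-≡ (≈ₚ⇒≋ {scale λ' C -ₚ A} {const k *ₚ B} rel) i ⟩
        coeff (const k *ₚ B) i                  ≡⟨ coeff-const*ₚ k B i ⟩
        k * coeff B i                           ∎

      condition : (Σ Mat λ M → IsAut f M × ¬ (Mat.β M ≈ₚ 0ₚ)) → Condition
      condition (mat α β γ δ , aut , β≉0) =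
        B≉0 b₀≠0 , k , ≋⇒≈ₚ {scale λ' C -ₚ A} {const k *ₚ B} (coeffwise kB) , w , ⁻¹-≢0 b₀≠0 , w²≡k²+λ
        where
        open Entries aut
        open EqualSizes a≡c sA≡1 tλ≡1 gcd-unit C-nonunit
        b₀≠0 = b₀≢0 β≉0
        w = b₀ ⁻¹
        k = u * a₀ * w
        bw≡1 : b₀ * w ≡ 1#
        bw≡1 = ⁻¹-inverse b₀ b₀≠0
        kB : ∀ i → coeff (scale λ' C -ₚ A) i ≡ coeff (const k *ₚ B) i
        kB i = begin
          coeff (scale λ' C -ₚ A) i                ≡⟨ trans (coeff--ₚ (scale λ' C) A i) (cong (_+ - coeff A i) (coeff-scale λ' C i)) ⟩
          X                                        ≡⟨ trans (cong (_* X) (*-identityˡ 1#)) (*-identityˡ X) ⟨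
          1# * 1# * X                              ≡⟨ cong₂ (λ x y → x * y * X) u²≡1 bw≡1 ⟨
          u * u * (b₀ * w) * X                     ≡⟨ solve 4 (λ u b w X → u :* u :* (b :* w) :* X := u :* w :* (u :* b :* X)) refl u b₀ w X ⟩
          u * w * (u * b₀ * X)                     ≡⟨ cong (u * w *_) (column-relation b₀≠0 i) ⟨
          u * w * (a₀ * coeff B i)                 ≡⟨ solve 4 (λ u w a Y → u :* w :* (a :* Y) := u :* a :* w :* Y) refl u w a₀ (coeff B i) ⟩
          k * coeff B i                            ≡⟨ coeff-const*ₚ k B i ⟨
          coeff (const k *ₚ B) i                   ∎
          where X = λ' * coeff C i + - coeff A i
        w²≡k²+λ : w * w ≡ k * k + λ'
        w²≡k²+λ = begin
          w * w                                    ≡⟨ *-identityʳ _ ⟨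
          w * w * 1#                               ≡⟨ cong (w * w *_) a²+λb²≡1 ⟨
          w * w * (a₀ * a₀ + λ' * b₀ * b₀)         ≡⟨ solve 4 (λ w a b λ' → w :* w :* (a :* a :+ λ' :* b :* b) := a :* a :* (w :* w) :+ λ' :* ((b :* w) :* (b :* w))) refl w a₀ b₀ λ' ⟩
          a₀ * a₀ * (w * w) + λ' * ((b₀ * w) * (b₀ * w)) ≡⟨ cong (λ z → a₀ * a₀ * (w * w) + λ' * (z * z)) bw≡1 ⟩
          a₀ * a₀ * (w * w) + λ' * (1# * 1#)       ≡⟨ solve 3 (λ a w λ' → a :* a :* (w :* w) :+ λ' :* (con (ℤ.+ 1) :* con (ℤ.+ 1)) := con (ℤ.+ 1) :* (a :* a :* (w :* w)) :+ λ') refl a₀ w λ' ⟩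
          1# * (a₀ * a₀ * (w * w)) + λ'            ≡⟨ cong (λ x → x * (a₀ * a₀ * (w * w)) + λ') u²≡1 ⟨
          u * u * (a₀ * a₀ * (w * w)) + λ'         ≡⟨ cong (_+ λ') (solve 3 (λ u a w → u :* u :* (a :* a :* (w :* w)) := u :* a :* w :* (u :* a :* w)) refl u a₀ w) ⟩
          k * k + λ'                               ∎

      isometry : Carrier → Carrier → Mat
      isometry k b = mat (const (- (b * k))) (const b) (const (λ' * b)) (const (b * k))

      isometry-automorphism : ∀ {k b} → (∀ i → λ' * coeff C i + - coeff A i ≡ k * coeff B i) →
                              b * b * (k * k + λ') ≡ 1# → IsAut f (isometry k b)
      isometry-automorphism {k} {b} λC-A≡kB b²[k²+λ]≡1 =
        (- 1# , -‿≢0 1≢0 , ≋⇒≈ₚ {det (isometry k b)} {const (- 1#)} (≋-trans (det-const ≋-refl ≋-refl ≋-refl ≋-refl) (coeffwise λ { zero → det≡-1 ; (suc i) → refl })))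
        , ≋⇒≈ₚ {A} {value f (const α₀) (const γ₀)} (coeffwise λ i → trans (preserves-A (λC-A≡kB i)) (sym (coeff-value-const A B C ≋-refl ≋-refl i)))
        , ≋⇒≈ₚ {B} {Form.B (f ∘F isometry k b)} (coeffwise λ i → trans (preserves-B (λC-A≡kB i)) (sym (coeff-cross-const A B C ≋-refl ≋-refl ≋-refl ≋-refl i)))
        , ≋⇒≈ₚ {C} {value f (const b) (const δ₀)} (coeffwise λ i → trans (preserves-C (λC-A≡kB i)) (sym (coeff-value-const A B C ≋-refl ≋-refl i)))
        where open NonTrivialIsometry b²[k²+λ]≡1

      construction : Condition →
                     Σ Mat λ M₁ → Σ Mat λ M₂ →
                       (IsAut f M₁ × ¬ (Mat.β M₁ ≈ₚ 0ₚ)) × (IsAut f M₂ × ¬ (Mat.β M₂ ≈ₚ 0ₚ)) × (¬ (M₁ ≈M M₂))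
                     × ((M : Mat) → IsAut f M → ¬ (Mat.β M ≈ₚ 0ₚ) → (M ≈M M₁) ⊎ (M ≈M M₂))
      construction (_ , k , rel , y , y≢0 , y²≡k²+λ) =
        isometry k w , isometry k (- w) ,
        (isometry-automorphism λC-A≡kB w²[k²+λ]≡1 , const≉0 w≢0) ,
        (isometry-automorphism λC-A≡kB (trans (cong (_* (k * k + λ')) (solve 1 (λ w → :- w :* :- w := w :* w) refl w)) w²[k²+λ]≡1) , const≉0 (-‿≢0 w≢0)) ,
        distinct , exhaustive
        where
        w = y ⁻¹
        w≢0 : w ≢ 0#
        w≢0 = ⁻¹-≢0 y≢0
        yw≡1 : y * w ≡ 1#
        yw≡1 = ⁻¹-inverse y y≢0
        λC-A≡kB : ∀ i → λ' * coeff C i + - coeff A i ≡ k * coeff B i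
        λC-A≡kB = relation⇒coefficients rel
        w²[k²+λ]≡1 : w * w * (k * k + λ') ≡ 1#
        w²[k²+λ]≡1 = begin
          w * w * (k * k + λ')     ≡⟨ cong (w * w *_) y²≡k²+λ ⟨
          w * w * (y * y)          ≡⟨ solve 2 (λ w y → w :* w :* (y :* y) := (y :* w) :* (y :* w)) refl w y ⟩
          (y * w) * (y * w)        ≡⟨ trans (cong₂ _*_ yw≡1 yw≡1) (*-identityˡ 1#) ⟩
          1#                       ∎
        distinct : ¬ (isometry k w ≈M isometry k (- w))
        distinct (_ , w≈-w , _) = w≢0 (x*y≡0⇒y≡0 2≢0 (begin
          2# * w        ≡⟨ solve 1 (λ w → con (ℤ.+ 2) :* w := w :+ w) refl w ⟩
          w + w         ≡⟨ cong (w +_) (coeff-≡ (≈ₚ⇒≋ {const w} {const (- w)} w≈-w) 0) ⟩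
          w + - w       ≡⟨ -‿inverseʳ w ⟩
          0#            ∎))
        exhaustive : (M : Mat) → IsAut f M → ¬ (Mat.β M ≈ₚ 0ₚ) → (M ≈M isometry k w) ⊎ (M ≈M isometry k (- w))
        exhaustive (mat α β γ δ) aut β≉0 =
          [ (λ b₀y≡1 → inj₁ (matches (trans (sym b₀≡b₀yw) (trans (cong (_* w) b₀y≡1) (*-identityˡ w)))))
          , (λ b₀y≡-1 → inj₂ (matches (trans (sym b₀≡b₀yw) (trans (cong (_* w) b₀y≡-1) (-1*x≈-x w)))))
          ]′ (x*x≡1⇒x≡±1 [b₀y]²≡1)
          where
          open Entries aut
          open EqualSizes a≡c sA≡1 tλ≡1 gcd-unit C-nonunit
          b₀≠0 = b₀≢0 β≉0
          i = proj₁ (nonzero-coefficient B (B≉0 b₀≠0))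
          Bᵢ = coeff B i
          a₀Bᵢ≡ : a₀ * Bᵢ ≡ - 1# * b₀ * (k * Bᵢ)
          a₀Bᵢ≡ = trans (column-relation b₀≠0 i) (cong₂ (λ x z → x * b₀ * z) (u≡-1 b₀≠0) (λC-A≡kB i))
          a₀≡-b₀k : a₀ ≡ - (b₀ * k)
          a₀≡-b₀k = +-inverseˡ-unique a₀ (b₀ * k) (x*y≡0⇒y≡0 (proj₂ (nonzero-coefficient B (B≉0 b₀≠0))) (begin
            Bᵢ * (a₀ + b₀ * k)                       ≡⟨ solve 4 (λ Y a b k → Y :* (a :+ b :* k) := a :* Y :+ :- (:- con (ℤ.+ 1) :* b :* (k :* Y))) refl Bᵢ a₀ b₀ k ⟩
            a₀ * Bᵢ + - (- 1# * b₀ * (k * Bᵢ))       ≡⟨ x≈y⇒x∙y⁻¹≈ε a₀Bᵢ≡ ⟩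
            0#                                       ∎))
          [b₀y]²≡1 : b₀ * y * (b₀ * y) ≡ 1#
          [b₀y]²≡1 = begin
            b₀ * y * (b₀ * y)                        ≡⟨ solve 2 (λ b y → b :* y :* (b :* y) := b :* b :* (y :* y)) refl b₀ y ⟩
            b₀ * b₀ * (y * y)                        ≡⟨ cong (b₀ * b₀ *_) y²≡k²+λ ⟩
            b₀ * b₀ * (k * k + λ')                   ≡⟨ solve 3 (λ b k λ' → b :* b :* (k :* k :+ λ') := :- (b :* k) :* :- (b :* k) :+ λ' :* b :* b) refl b₀ k λ' ⟩
            - (b₀ * k) * - (b₀ * k) + λ' * b₀ * b₀   ≡⟨ cong (λ z → z * z + λ' * b₀ * b₀) a₀≡-b₀k ⟨
            a₀ * a₀ + λ' * b₀ * b₀                   ≡⟨ a²+λb²≡1 ⟩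
            1#                                       ∎
          b₀≡b₀yw : b₀ * y * w ≡ b₀
          b₀≡b₀yw = trans (*-assoc b₀ y w) (trans (cong (b₀ *_) yw≡1) (*-identityʳ b₀))
          matches : ∀ {b} → b₀ ≡ b → mat α β γ δ ≈M isometry k b
          matches refl =
              ≋const⇒≈ₚ α≋a₀ a₀≡-b₀k
            , ≋⇒≈ₚ β≋b₀
            , ≋const⇒≈ₚ γ≋c₀ (trans c≡-uλb (trans (cong (λ z → - (z * λ' * b₀)) (u≡-1 b₀≠0))
                               (solve 2 (λ λ' b → :- (:- con (ℤ.+ 1) :* λ' :* b) := λ' :* b) refl λ' b₀)))
            , ≋const⇒≈ₚ δ≋d₀ (trans d≡ua (trans (cong₂ _*_ (u≡-1 b₀≠0) a₀≡-b₀k)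
                               (solve 2 (λ b k → :- con (ℤ.+ 1) :* :- (b :* k) := b :* k) refl b₀ k)))

  positive-size⇒degree : ∀ p → 0 < size p → ∃[ d ] HasDegree p d
  positive-size⇒degree p 0<size with zero⊎degree p
  ... | inj₁ p≋[]    = ⊥-elim (ℕ.<-irrefl (sym (≋[]⇒size≡0 p≋[])) 0<size)
  ... | inj₂ degree  = degree

  size<⇒vanishes : ∀ p {a} → size p < suc a → ∀ i → a ≤ i → coeff p i ≡ 0#
  size<⇒vanishes p {a} size<1+a i a≤i with zero⊎degree p
  ... | inj₁ p≋[]             = coeff-≡ p≋[] i
  ... | inj₂ (b , p≤b , pb≢0) = p≤b i (ℕ.<-≤-trans b<a a≤i)
    where
    b<a : b < a
    b<a = ℕ.≤-pred (subst (_< suc a) (proj₁ (degree⇒size,sgn {p} (p≤b , pb≢0))) size<1+a)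

  module PartiallyReducedForm {h : Carrier} (A B C : Poly) (reduced : PartiallyReduced h (form A B C)) where

    private
      |B|<|A| : size B < size A
      |B|<|A| = proj₁ (proj₁ reduced)

      |A|≤|C| : size A ≤ size C
      |A|≤|C| = proj₂ (proj₁ reduced)

    a c : ℕ
    a = proj₁ (positive-size⇒degree A (ℕ.<-≤-trans (s≤s z≤n) |B|<|A|))
    c = proj₁ (positive-size⇒degree C (ℕ.<-≤-trans (s≤s z≤n) (ℕ.<-≤-trans |B|<|A| |A|≤|C|)))

    A-degree : HasDegree A a
    A-degree = proj₂ (positive-size⇒degree A (ℕ.<-≤-trans (s≤s z≤n) |B|<|A|))

    C-degree : HasDegree C c
    C-degree = proj₂ (positive-size⇒degree C (ℕ.<-≤-trans (s≤s z≤n) (ℕ.<-≤-trans |B|<|A| |A|≤|C|)))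

    size-A : size A ≡ suc a
    size-A = proj₁ (degree⇒size,sgn {A} A-degree)

    size-C : size C ≡ suc c
    size-C = proj₁ (degree⇒size,sgn {C} C-degree)

    a≤c : a ≤ c
    a≤c = ℕ.≤-pred (subst₂ _≤_ size-A size-C |A|≤|C|)

    B-small : ∀ i → a ≤ i → coeff B i ≡ 0#
    B-small = size<⇒vanishes B (subst (size B <_) size-A |B|<|A|)

    |A|<|C|⇒a<c : size A < size C → a < c
    |A|<|C|⇒a<c |A|<|C| = ℕ.≤-pred (subst₂ _<_ size-A size-C |A|<|C|)

    |A|≡|C|⇒a≡c : size A ≡ size C → a ≡ c
    |A|≡|C|⇒a≡c |A|≡|C| = ℕ.suc-injective (trans (sym size-A) (trans |A|≡|C| size-C))

    |A|≡|C|⇒sgnA≡1 : size A ≡ size C → coeff A a ≡ 1#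
    |A|≡|C|⇒sgnA≡1 |A|≡|C| = trans (sym (proj₂ (degree⇒size,sgn {A} A-degree))) (proj₁ (proj₂ (proj₂ reduced)) |A|≡|C|)

theorem3p7 :
  (𝔽 : FiniteField) →
  let open FiniteField 𝔽
      open Over 𝔽
  in
  -- q = |F_q| is a power of a prime p ≥ 5 = char F_q
  (p n : ℕ) → Prime p → 5 ≤ p → q ≡ p ^ n → natToF p ≡ 0# →
  -- a fixed primitive root h
  (h : Carrier) → IsPrimitiveRoot h →
  -- the form f = (A,B,C) with discriminant D
  (A B C : Poly) →
  let f = form A B C
      D = disc f
      λ' = lam h
  in
  Primitive f → Irreducible f → NonConstant D →
  (Imaginary D ⊎ Unusual D) → Normalized h D →
  PartiallyReduced h f →
  -- statements about an arbitrary automorphism M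
  ((M : Mat) → IsAut f M →
      (size A < size C →
         (M ≈M I) ⊎ (M ≈M negM I) ⊎ (B ≈ₚ 0ₚ × ((M ≈M J) ⊎ (M ≈M negM J))))
    × (size A ≡ size C →
         Σ Carrier λ a → Σ Carrier λ b → Σ Carrier λ u →
           (u ≡ 1# ⊎ u ≡ - 1#) × (det M ≈ₚ const u)
         × (M ≈M mat (const a) (const b) (const (- (u * λ' * b))) (const (u * a)))
         × (¬ b ≡ 0# →
              (¬ B ≈ₚ 0ₚ)
            × (const a *ₚ B ≈ₚ const (u * b) *ₚ (scale λ' C -ₚ A)))))
  -- existence and number of the non-trivial automorphisms (β ≠ 0)
  × (size A ≡ size C →
       let Cond = (¬ B ≈ₚ 0ₚ)
                × Σ Carrier λ k → (scale λ' C -ₚ A ≈ₚ const k *ₚ B)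
                × Σ Carrier λ y → (¬ y ≡ 0#) × (y * y ≡ k * k + λ')
       in
         ((Σ Mat λ M → IsAut f M × ¬ (Mat.β M ≈ₚ 0ₚ)) → Cond)
       × (Cond →
            Σ Mat λ M₁ → Σ Mat λ M₂ →
              (IsAut f M₁ × ¬ (Mat.β M₁ ≈ₚ 0ₚ))
            × (IsAut f M₂ × ¬ (Mat.β M₂ ≈ₚ 0ₚ))
            × (¬ (M₁ ≈M M₂))
            × ((M : Mat) → IsAut f M → ¬ (Mat.β M ≈ₚ 0ₚ) →
                 (M ≈M M₁) ⊎ (M ≈M M₂))))
theorem3p7 𝔽 p n p-prime 5≤p _ p≡0 h _ A B C gcd-unit _ nonconstant imaginary⊎unusual normalized reduced =
    (λ M aut → (λ |A|<|C| → Entries.UnequalSizes.classification aut (|A|<|C|⇒a<c |A|<|C|))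
             , (λ |A|≡|C| → Equal.standard-form |A|≡|C| M aut))
  , (λ |A|≡|C| → Equal.condition |A|≡|C| , Equal.construction |A|≡|C|)
  where
  open FiniteField 𝔽 using (0#)
  open Over 𝔽 using (size)
  open AutomorphismsOverFiniteField 𝔽
  open PartiallyReducedForm A B C reduced

  2≢0 : 2# ≢ 0#
  2≢0 = odd-characteristic⇒2≢0 p-prime (ℕ.≤-trans (s≤s (s≤s (s≤s z≤n))) 5≤p) p≡0

  open ReducedForm A B C A-degree C-degree a≤c B-small 2≢0
  open Automorphisms A B C A-degree C-degree a≤c B-small 2≢0 imaginary⊎unusual

  module Equal (|A|≡|C| : size A ≡ size C) = NonTrivial
    (|A|≡|C|⇒a≡c |A|≡|C|) (|A|≡|C|⇒sgnA≡1 |A|≡|C|)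
    (leading-C*λ≡1 (|A|≡|C|⇒a≡c |A|≡|C|) (|A|≡|C|⇒sgnA≡1 |A|≡|C|) imaginary⊎unusual normalized)
    gcd-unit (equal-degrees⇒C-nonunit (|A|≡|C|⇒a≡c |A|≡|C|) nonconstant)
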